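{- Let $G$ be a directed graph with a $1$-factor $f$, and let $A_1, A_2$ be $f$-alternating circuits in $G$. Then $A_1$ and $A_2$ are of opposite clockwise parity if and only if $A_1 + A_2$ includes an odd number of clockwise even alternating circuits.
   Context: A $1$-factor is a set of edges covering every vertex exactly once. A circuit is $f$-alternating if it is included in the symmetric difference of $f$ and some other $1$-factor; it is alternating if included in the symmetric difference of two $1$-factors. Circuits are identified with their edge sets, and $A_1+A_2$ denotes the symmetric difference (which, for $f$-alternating circuits, is an edge-disjoint union of alternating circuits; "includes" refers to these circuits). The clockwise parity of a circuit of even length in a directed graph is the parity of the number of its edges directed in agreement with a chosen sense of traversal; the circuit is clockwise even or clockwise odd accordingly. -}

module Defs where

open import Data.Nat using (ℕ; suc; _%_; _+_)
open import Data.Nat.DivMod using (m%n<n)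
open import Data.Fin using (Fin; toℕ; fromℕ<; _≟_)
open import Data.Fin.Subset using (Subset; _∈_; _⊆_)
open import Data.Bool using (Bool; _xor_; if_then_else_)
open import Data.Vec using (zipWith)
open import Data.List using (List; length; map; allFin)
open import Data.Nat.ListAction using (sum)
open import Data.List.Relation.Unary.Unique.Propositional using (Unique)
import Data.List.Membership.Propositional
open import Data.Product using (Σ; _×_; _,_; ∃)
open import Data.Sum using (_⊎_)
open import Function.Bundles using (_⇔_)
open import Relation.Nullary.Decidable using (⌊_⌋)
open import Relation.Binary.PropositionalEquality using (_≡_; _≢_)

record Digraph : Set where
  field
    n    : ℕ
    m    : ℕ
    tail : Fin m → Fin n
    head : Fin m → Fin n

Even : ℕ → Set
Even k = k % 2 ≡ 0

Odd : ℕ → Set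
Odd k = k % 2 ≡ 1

module _ (G : Digraph) where
  open Digraph G

  EdgeSet : Set
  EdgeSet = Subset m

  _⊕_ : EdgeSet → EdgeSet → EdgeSet
  A ⊕ B = zipWith _xor_ A B

  Incident : Fin m → Fin n → Set
  Incident e v = (tail e ≡ v) ⊎ (head e ≡ v)

  IsOneFactor : EdgeSet → Set
  IsOneFactor F = ∀ v → Σ (Fin m) λ e →
    (e ∈ F) × Incident e v × (∀ e′ → e′ ∈ F → Incident e′ v → e′ ≡ e)

  Joins : Fin m → Fin n → Fin n → Set
  Joins e u w = (tail e ≡ u × head e ≡ w) ⊎ (tail e ≡ w × head e ≡ u)

  next : ∀ {k} → Fin (suc k) → Fin (suc k)
  next {k} i = fromℕ< (m%n<n (suc (toℕ i)) (suc k))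

  record Traversal : Set where
    field
      len   : ℕ
      vert  : Fin (suc (suc len)) → Fin n
      edge  : Fin (suc (suc len)) → Fin m
      vert-inj : ∀ i j → vert i ≡ vert j → i ≡ j
      edge-inj : ∀ i j → edge i ≡ edge j → i ≡ j
      joins : ∀ i → Joins (edge i) (vert i) (vert (next i))

    length′ : ℕ
    length′ = suc (suc len)

    agreements : ℕ
    agreements = sum (map (λ i → if ⌊ tail (edge i) ≟ vert i ⌋ then 1 else 0)
                          (allFin (suc (suc len))))

  open Traversal public

  Traverses : Traversal → EdgeSet → Set
  Traverses t C = ∀ e → (e ∈ C) ⇔ (Σ (Fin (suc (suc (len t)))) λ i → edge t i ≡ e)

  IsCircuit : EdgeSet → Set
  IsCircuit C = Σ Traversal λ t → Traverses t C

  -- clockwise parity (defined for circuits of even length; it does not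
  -- depend on the chosen traversal in that case)
  ClockwiseEven : EdgeSet → Set
  ClockwiseEven C = Σ Traversal λ t → Traverses t C × Even (length′ t) × Even (agreements t)

  ClockwiseOdd : EdgeSet → Set
  ClockwiseOdd C = Σ Traversal λ t → Traverses t C × Even (length′ t) × Odd (agreements t)

  IsFAlternating : EdgeSet → EdgeSet → Set
  IsFAlternating f C = IsCircuit C × Σ EdgeSet λ F′ → IsOneFactor F′ × (C ⊆ (f ⊕ F′))

  IsAlternating : EdgeSet → Set
  IsAlternating C = IsCircuit C ×
    Σ EdgeSet λ F₁ → Σ EdgeSet λ F₂ → IsOneFactor F₁ × IsOneFactor F₂ × (C ⊆ (F₁ ⊕ F₂))

  HasCount : (EdgeSet → Set) → ℕ → Set
  HasCount P k = Σ (List EdgeSet) λ L →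
    Unique L × (∀ C → (C Data.List.Membership.Propositional.∈ L) ⇔ P C) × length L ≡ k

-- Give every 1-factor M the sign of its term in the Pfaffian, i.e. the parity of the inversions of the
-- word formed by the endpoints of its edges, each edge read from tail to head.  The key fact is that
-- swapping M along an M-alternating circuit C changes the sign exactly when C is clockwise even: the two
-- perfect matchings of the even cycle C have signs differing by one plus the number of edges directed
-- along C, while the edges of M off C cross C an even number of times.  As this does not refer
-- to a traversal, the clockwise parity of C is well defined.
--
-- For i = 1, 2 the edge set gᵢ = f + Aᵢ is a 1-factor, and sign f + sign gᵢ records the clockwise parity
-- of Aᵢ.  Moreover g₁ + g₂ = A₁ + A₂ is an edge-disjoint union of alternating circuits; swapping g₁
-- along them one at a time turns it into g₂ and changes the sign once per clockwise even circuit.  So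
-- sign g₁ + sign g₂ is both the parity of the number of clockwise even circuits in A₁ + A₂ and the
-- difference of the clockwise parities of A₁ and A₂.

module Submission where

open import Defs
open import Data.Bool using (Bool; true; false; not; _∧_; _xor_; T; if_then_else_)
open import Data.Bool.Properties
  using (xor-assoc; xor-comm; xor-same; xor-identityʳ; not-involutive; not-injective; not-¬;
         not-distribˡ-xor; not-distribʳ-xor; ∧-distribˡ-xor; ∧-distribʳ-xor; T-≡)
import Data.Bool.Properties as Bool
open import Data.Empty using (⊥; ⊥-elim)
open import Data.Fin as Fin using (Fin; toℕ; fromℕ<; _≟_)
open import Data.Fin.Properties using (toℕ-injective; toℕ-fromℕ<; toℕ<n; pigeonhole; any?)
open import Data.Fin.Subset using (_⊆_; _⊂_; _∈_; ∣_∣; Empty) renaming (⊥ to ∅)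
open import Data.Fin.Subset.Properties using (nonempty?; Empty-unique; p⊂q⇒∣p∣<∣q∣; ∉⊥)
open import Data.List using (List; []; _∷_; _++_; [_]; map; length; filter; allFin)
open import Data.List.Properties using (map-++; length-map)
open import Data.List.Membership.Propositional using (find; lose) renaming (_∈_ to _∈ₗ_)
open import Data.List.Membership.Propositional.Properties using (∈-allFin; ∈-map⁺; ∈-map⁻; ∈-filter⁺; ∈-filter⁻)
open import Data.List.Membership.Propositional.Properties.WithK using (unique∧set⇒bag)
open import Data.List.Relation.Binary.BagAndSetEquality using (∼bag⇒↭)
open import Data.List.Relation.Binary.Permutation.Propositional as ↭ using (_↭_)
open import Data.List.Relation.Binary.Permutation.Propositional.Properties using (↭-length)
open import Data.List.Relation.Unary.All as All using ()
open import Data.List.Relation.Unary.AllPairs as AllPairs using (AllPairs; []; _∷_)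
import Data.List.Relation.Unary.AllPairs.Properties as AllPairs
import Data.List.Relation.Unary.Any as Any
open import Data.List.Relation.Unary.Any using (here; there)
open import Data.List.Relation.Unary.Unique.Propositional using (Unique)
open import Data.List.Relation.Unary.Unique.Propositional.Properties using (allFin⁺; filter⁺)
open import Data.Nat using (ℕ; zero; suc; _+_; _∸_; _<_; _≤_; _<ᵇ_; _%_; z≤n; s≤s; z<s)
open import Data.Nat.DivMod using (m%n<n; %-distribˡ-+; m%n%n≡m%n; n%n≡0; m<n⇒m%n≡m; [m+n]%n≡m%n)
open import Data.Nat.Induction using (<-rec)
open import Data.Nat.ListAction using (sum)
open import Data.Nat.Properties hiding (_≟_)
open import Data.Product using (Σ; _×_; _,_; proj₁; proj₂)
open import Data.Sum as Sum using (_⊎_; inj₁; inj₂)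
open import Data.Vec using (lookup; tabulate)
open import Data.Vec.Properties using (lookup-zipWith; []=⇒lookup; lookup⇒[]=; lookup∘tabulate; tabulate-cong; tabulate∘lookup; lookup-replicate)
open import Function using (_∘_; _∘′_)
open import Function.Bundles using (Equivalence; _⇔_; mk⇔)
open import Relation.Binary.Definitions using (tri<; tri≈; tri>)
open import Relation.Binary.PropositionalEquality hiding ([_])
open import Relation.Nullary using (¬_; Dec; yes; no; ofʸ; ofⁿ)
open import Relation.Nullary.Decidable using (⌊_⌋; T?; toWitness; isYes≗does; dec-true; dec-false)

private variable
  A B : Set


-- Boolean identities and sums modulo 2
BoolFunction : ℕ → Set
BoolFunction zero    = Bool
BoolFunction (suc n) = Bool → BoolFunction n

_≋_ : ∀ {n} → BoolFunction n → BoolFunction n → Set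
_≋_ {zero}  f g = f ≡ g
_≋_ {suc n} f g = ∀ b → f b ≋ g b

agree : ∀ n → BoolFunction n → BoolFunction n → Bool
agree zero    f g = ⌊ f Bool.≟ g ⌋
agree (suc n) f g = agree n (f false) (g false) ∧ agree n (f true) (g true)

-- Identities between boolean functions, checked at all 2ⁿ arguments: the functions are found by
-- unification with the stated identity, and the check itself by evaluation.
by-truth-table : ∀ n {f g : BoolFunction n} {_ : T (agree n f g)} → f ≋ g
by-truth-table zero    {f} {g} {ok} = toWitness ok
by-truth-table (suc n) {f} {g} {ok} false = by-truth-table n {_} {_} {proj₁ (Equivalence.to Bool.T-∧ ok)}
by-truth-table (suc n) {f} {g} {ok} true  = by-truth-table n {_} {_} {proj₂ (Equivalence.to Bool.T-∧ ok)}

false≢true : false ≢ true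
false≢true ()

xor≡true⇒≡not : ∀ a {b} → a xor b ≡ true → b ≡ not a
xor≡true⇒≡not false         p = p
xor≡true⇒≡not true {false} p = refl

xor≡true∧false⇒true : ∀ {a b} → a xor b ≡ true → b ≡ false → a ≡ true
xor≡true∧false⇒true {true}  _    _  = refl
xor≡true∧false⇒true {false} refl ()

when-both-true : ∀ a b {x y} → (a ≡ true → b ≡ true → x ≡ y) → (a ∧ b) ∧ x ≡ (a ∧ b) ∧ y
when-both-true true  true  x≡y = x≡y refl refl
when-both-true true  false _   = refl
when-both-true false b     _   = refl

bool-ext : ∀ {a b} → (a ≡ true → b ≡ true) → (b ≡ true → a ≡ true) → a ≡ b
bool-ext {false} {false} _ _ = refl
bool-ext {false} {true}  _ b⇒a = b⇒a refl
bool-ext {true}  {false} a⇒b _ = sym (a⇒b refl)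
bool-ext {true}  {true}  _ _ = refl

xor≡true∧true⇒false : ∀ {a b} → a xor b ≡ true → b ≡ true → a ≡ false
xor≡true∧true⇒false {false} _  _    = refl
xor≡true∧true⇒false {true}  () refl

xor≡false⇒≡ : ∀ {a b} → a xor b ≡ false → a ≡ b
xor≡false⇒≡ {false} eq = sym eq
xor≡false⇒≡ {true}  eq = sym (trans (sym (not-involutive _)) (cong not eq))

parity : ℕ → Bool
parity zero    = false
parity (suc n) = not (parity n)

parity-+ : ∀ m n → parity (m + n) ≡ parity m xor parity n
parity-+ zero    n = refl
parity-+ (suc m) n = trans (cong not (parity-+ m n)) (not-distribˡ-xor (parity m) (parity n))

parity-%2 : ∀ n → n % 2 ≡ (if parity n then 1 else 0)
parity-%2 zero          = refl
parity-%2 (suc zero)    = refl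
parity-%2 (suc (suc n)) = begin
  (suc (suc n)) % 2        ≡⟨ cong (_% 2) (+-comm 2 n) ⟩
  (n + 2) % 2              ≡⟨ [m+n]%n≡m%n n 2 ⟩
  n % 2                    ≡⟨ parity-%2 n ⟩
  (if parity n then 1 else 0) ≡⟨ cong (λ b → if b then 1 else 0) (sym (not-involutive (parity n))) ⟩
  (if parity (suc (suc n)) then 1 else 0) ∎
  where open ≡-Reasoning
  

Even⇔parity≡false : ∀ n → Even n ⇔ (parity n ≡ false)
Even⇔parity≡false n = mk⇔ to (λ p → trans (parity-%2 n) (cong (λ b → if b then 1 else 0) p))
  where
  to : Even n → parity n ≡ false
  to even with parity n | parity-%2 n
  ... | false | _ = refl
  ... | true  | n%2≡1 with () ← trans (sym n%2≡1) even

Odd⇔parity≡true : ∀ n → Odd n ⇔ (parity n ≡ true)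
Odd⇔parity≡true n = mk⇔ to (λ p → trans (parity-%2 n) (cong (λ b → if b then 1 else 0) p))
  where
  to : Odd n → parity n ≡ true
  to odd with parity n | parity-%2 n
  ... | true  | _ = refl
  ... | false | n%2≡0 with () ← trans (sym n%2≡0) odd

xorSum : List A → (A → Bool) → Bool
xorSum []       f = false
xorSum (x ∷ xs) f = f x xor xorSum xs f

xorSum-cong : ∀ xs {f g : A → Bool} → (∀ x → f x ≡ g x) → xorSum xs f ≡ xorSum xs g
xorSum-cong []       f≗g = refl
xorSum-cong (x ∷ xs) f≗g = cong₂ _xor_ (f≗g x) (xorSum-cong xs f≗g)

xorSum-cong-∈ : ∀ xs {f g : A → Bool} → (∀ {x} → x ∈ₗ xs → f x ≡ g x) → xorSum xs f ≡ xorSum xs g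
xorSum-cong-∈ []       f≗g = refl
xorSum-cong-∈ (x ∷ xs) f≗g = cong₂ _xor_ (f≗g (here refl)) (xorSum-cong-∈ xs (f≗g ∘ there))

xorSum-false : ∀ (xs : List A) → xorSum xs (λ _ → false) ≡ false
xorSum-false []       = refl
xorSum-false (x ∷ xs) = xorSum-false xs

xorSum-true : ∀ (xs : List A) → xorSum xs (λ _ → true) ≡ parity (length xs)
xorSum-true []       = refl
xorSum-true (x ∷ xs) = cong not (xorSum-true xs)

xorSum-xor : ∀ xs (f g : A → Bool) → xorSum xs (λ x → f x xor g x) ≡ xorSum xs f xor xorSum xs g
xorSum-xor []       f g = refl
xorSum-xor (x ∷ xs) f g = trans (cong ((f x xor g x) xor_) (xorSum-xor xs f g))
                                  (interchange (f x) (g x) (xorSum xs f) (xorSum xs g))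
  where
  interchange : ∀ a b c d → (a xor b) xor (c xor d) ≡ (a xor c) xor (b xor d)
  interchange = by-truth-table 4

xorSum-∧ˡ : ∀ xs b (f : A → Bool) → xorSum xs (λ x → b ∧ f x) ≡ b ∧ xorSum xs f
xorSum-∧ˡ []       false f = refl
xorSum-∧ˡ []       true  f = refl
xorSum-∧ˡ (x ∷ xs) b     f = trans (cong ((b ∧ f x) xor_) (xorSum-∧ˡ xs b f))
                                     (sym (∧-distribˡ-xor b (f x) (xorSum xs f)))

xorSum-++ : ∀ xs ys (f : A → Bool) → xorSum (xs ++ ys) f ≡ xorSum xs f xor xorSum ys f
xorSum-++ []       ys f = refl
xorSum-++ (x ∷ xs) ys f = trans (cong (f x xor_) (xorSum-++ xs ys f)) (sym (xor-assoc (f x) _ _))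

xorSum-map : ∀ (g : B → A) xs (f : A → Bool) → xorSum (map g xs) f ≡ xorSum xs (f ∘ g)
xorSum-map g []       f = refl
xorSum-map g (x ∷ xs) f = cong (f (g x) xor_) (xorSum-map g xs f)

xorSum-comm : ∀ xs (ys : List B) (F : A → B → Bool) →
              xorSum xs (λ x → xorSum ys (F x)) ≡ xorSum ys (λ y → xorSum xs (λ x → F x y))
xorSum-comm []       ys F = sym (xorSum-false ys)
xorSum-comm (x ∷ xs) ys F = trans (cong (xorSum ys (F x) xor_) (xorSum-comm xs ys F))
                                    (sym (xorSum-xor ys (F x) (λ y → xorSum xs (λ x′ → F x′ y))))

xorSum-filter : ∀ (w : A → Bool) xs f → xorSum xs (λ x → w x ∧ f x) ≡ xorSum (filter (T? ∘ w) xs) f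
xorSum-filter w []       f = refl
xorSum-filter w (x ∷ xs) f with w x
... | true  = cong (f x xor_) (xorSum-filter w xs f)
... | false = xorSum-filter w xs f

xorSum-↭ : ∀ {xs ys : List A} → xs ↭ ys → ∀ f → xorSum xs f ≡ xorSum ys f
xorSum-↭ ↭.refl          f = refl
xorSum-↭ (↭.prep x p)    f = cong (f x xor_) (xorSum-↭ p f)
xorSum-↭ (↭.swap x y p)  f = trans (cong (λ s → f x xor (f y xor s)) (xorSum-↭ p f)) (swap-heads (f x) (f y) _)
  where
  swap-heads : ∀ a b c → a xor (b xor c) ≡ b xor (a xor c)
  swap-heads = by-truth-table 3
xorSum-↭ (↭.trans p q)   f = trans (xorSum-↭ p f) (xorSum-↭ q f)

parity-sum-indicator : ∀ (xs : List A) b → parity (sum (map (λ x → if b x then 1 else 0) xs)) ≡ xorSum xs b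
parity-sum-indicator []       b = refl
parity-sum-indicator (x ∷ xs) b =
  trans (parity-+ (if b x then 1 else 0) _) (cong₂ _xor_ (indicator (b x)) (parity-sum-indicator xs b))
  where
  indicator : ∀ c → parity (if c then 1 else 0) ≡ c
  indicator false = refl
  indicator true  = refl

unique-same-members-↭ : {xs ys : List A} → Unique xs → Unique ys → (∀ {x} → x ∈ₗ xs ⇔ x ∈ₗ ys) → xs ↭ ys
unique-same-members-↭ u v same = ∼bag⇒↭ (unique∧set⇒bag u v same)

enumerations-same-length : ∀ {P : A → Set} {xs ys : List A} → Unique xs → Unique ys →
                           (∀ x → x ∈ₗ xs ⇔ P x) → (∀ x → x ∈ₗ ys ⇔ P x) → length xs ≡ length ys
enumerations-same-length xs! ys! xs-enum ys-enum = ↭-length (unique-same-members-↭ xs! ys!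
  λ {x} → mk⇔ (Equivalence.from (ys-enum x) ∘ Equivalence.to (xs-enum x))
      (Equivalence.from (xs-enum x) ∘ Equivalence.to (ys-enum x)))


-- Rising pairs of sequences of numbers
_>ᵇ_ : ℕ → ℕ → Bool
a >ᵇ b = b <ᵇ a

>ᵇ-true : ∀ {a b} → b < a → (a >ᵇ b) ≡ true
>ᵇ-true {a} {b} b<a with b <ᵇ a | <ᵇ-reflects-< b a
... | true  | _       = refl
... | false | ofⁿ b≮a = ⊥-elim (b≮a b<a)

>ᵇ-false : ∀ {a b} → ¬ b < a → (a >ᵇ b) ≡ false
>ᵇ-false {a} {b} b≮a with b <ᵇ a | <ᵇ-reflects-< b a
... | false | _       = refl
... | true  | ofʸ b<a = ⊥-elim (b≮a b<a)

>ᵇ-irrefl : ∀ a → (a >ᵇ a) ≡ false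
>ᵇ-irrefl a = >ᵇ-false {a} (<-irrefl refl)

>ᵇ-xor-flip : ∀ {a b} → a ≢ b → (a >ᵇ b) xor (b >ᵇ a) ≡ true
>ᵇ-xor-flip {a} {b} a≢b with <-cmp a b
... | tri< a<b _ _ = cong₂ _xor_ (>ᵇ-false (<-asym a<b)) (>ᵇ-true a<b)
... | tri≈ _ a≡b _ = ⊥-elim (a≢b a≡b)
... | tri> _ _ b<a = cong₂ _xor_ (>ᵇ-true b<a) (>ᵇ-false (<-asym b<a))

risingBetween : ℕ → ℕ → ℕ → ℕ → Bool
risingBetween a b c d = ((c >ᵇ a xor c >ᵇ b) xor d >ᵇ a) xor d >ᵇ b

risingBetween-swap : ∀ {a b c d} → a ≢ c → a ≢ d → b ≢ c → b ≢ d → risingBetween a b c d ≡ risingBetween c d a b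
risingBetween-swap {a} {b} {c} {d} a≢c a≢d b≢c b≢d = begin
  ((c >ᵇ a xor c >ᵇ b) xor d >ᵇ a) xor d >ᵇ b
    ≡⟨ cong₂ _xor_ (cong₂ _xor_ (cong₂ _xor_ (flip a≢c) (flip b≢c)) (flip a≢d)) (flip b≢d) ⟩
  (((true xor a >ᵇ c) xor (true xor b >ᵇ c)) xor (true xor a >ᵇ d)) xor (true xor b >ᵇ d)
    ≡⟨ regroup (a >ᵇ c) (b >ᵇ c) (a >ᵇ d) (b >ᵇ d) ⟩
  ((a >ᵇ c xor a >ᵇ d) xor b >ᵇ c) xor b >ᵇ d ∎
  where
  open ≡-Reasoning
  flip : ∀ {x y} → x ≢ y → (y >ᵇ x) ≡ true xor (x >ᵇ y)
  flip {x} {y} x≢y = xor≡true⇒≡not (x >ᵇ y) (>ᵇ-xor-flip x≢y)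
  regroup : ∀ p q r s → (((true xor p) xor (true xor q)) xor (true xor r)) xor (true xor s) ≡
      ((p xor r) xor q) xor s
  regroup = by-truth-table 4

risingBetween-swapˡ : ∀ a b c d → risingBetween a b c d ≡ risingBetween b a c d
risingBetween-swapˡ a b c d = regroup (c >ᵇ a) (c >ᵇ b) (d >ᵇ a) (d >ᵇ b)
  where
  regroup : ∀ p q r s → ((p xor q) xor r) xor s ≡ ((q xor p) xor s) xor r
  regroup = by-truth-table 4

risingBetween-swapʳ : ∀ a b c d → risingBetween a b c d ≡ risingBetween a b d c
risingBetween-swapʳ a b c d = regroup (c >ᵇ a) (c >ᵇ b) (d >ᵇ a) (d >ᵇ b)
  where
  regroup : ∀ p q r s → ((p xor q) xor r) xor s ≡ ((r xor s) xor p) xor q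
  regroup = by-truth-table 4

risingBetween-split : ∀ a b c d → risingBetween a b c d ≡ (c >ᵇ a xor c >ᵇ b) xor (d >ᵇ a xor d >ᵇ b)
risingBetween-split a b c d = regroup (c >ᵇ a) (c >ᵇ b) (d >ᵇ a) (d >ᵇ b)
  where
  regroup : ∀ p q r s → ((p xor q) xor r) xor s ≡ (p xor q) xor (r xor s)
  regroup = by-truth-table 4

pairSum : List A → (A → A → Bool) → Bool
pairSum []       F = false
pairSum (x ∷ xs) F = xorSum xs (F x) xor pairSum xs F

risingPairs : List ℕ → Bool
risingPairs xs = pairSum xs (λ x y → y >ᵇ x)

range : ℕ → ℕ → List ℕ
range s zero    = []
range s (suc k) = s ∷ range (suc s) k

double : ℕ → ℕ
double zero    = zero
double (suc p) = suc (suc (double p))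

everyOther : ℕ → ℕ → List ℕ
everyOther s zero    = []
everyOther s (suc p) = s ∷ everyOther (suc (suc s)) p

parity-double : ∀ p → parity (double p) ≡ false
parity-double zero    = refl
parity-double (suc p) = trans (not-involutive (parity (double p))) (parity-double p)

parity≡false⇒double : ∀ k → parity k ≡ false → Σ ℕ λ p → k ≡ double p
parity≡false⇒double zero                _ = 0 , refl
parity≡false⇒double (suc (suc k)) even with parity≡false⇒double k (trans (sym (not-involutive (parity k))) even)
... | p , refl = suc p , refl

length-range : ∀ s k → length (range s k) ≡ k
length-range s zero    = refl
length-range s (suc k) = cong suc (length-range (suc s) k)

range-snoc : ∀ s k → range s (suc k) ≡ range s k ++ [ s + k ]
range-snoc s zero    = cong [_] (sym (+-identityʳ s))
range-snoc s (suc k) = cong (s ∷_)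
    (trans (range-snoc (suc s) k) (cong (λ z → range (suc s) k ++ [ z ]) (sym (+-suc s k))))

∈-range⁻ : ∀ s k {j} → j ∈ₗ range s k → s ≤ j × j < s + k
∈-range⁻ s (suc k) (here refl) = ≤-refl , subst (s <_) (sym (+-suc s k)) (s≤s (m≤m+n s k))
∈-range⁻ s (suc k) {j} (there j∈) with ∈-range⁻ (suc s) k j∈
... | s<j , j<s+k = <⇒≤ s<j , subst (j <_) (sym (+-suc s k)) j<s+k

∈-range⁺ : ∀ s k {j} → s ≤ j → j < s + k → j ∈ₗ range s k
∈-range⁺ s zero    s≤j j<s+k = ⊥-elim (<-irrefl refl (≤-<-trans (subst (_≤ _) (sym (+-identityʳ s)) s≤j) j<s+k))
∈-range⁺ s (suc k) {j} s≤j j<s+k with m≤n⇒m<n∨m≡n s≤j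
... | inj₂ refl = here refl
... | inj₁ s<j  = there (∈-range⁺ (suc s) k s<j (subst (j <_) (+-suc s k) j<s+k))

range-ordered : ∀ s k → AllPairs (λ i j → i < j × j < s + k) (range s k)
range-ordered s zero    = []
range-ordered s (suc k) =
  All.tabulate (λ j∈ → proj₁ (∈-range⁻ (suc s) k j∈) , below (proj₂ (∈-range⁻ (suc s) k j∈)))
  ∷ AllPairs.map (λ (i<j , j<) → i<j , below j<) (range-ordered (suc s) k)
  where
  below : ∀ {j} → j < suc s + k → j < s + suc k
  below {j} = subst (j <_) (sym (+-suc s k))

unique-map-range : ∀ (f : ℕ → A) L → (∀ {i j} → i < L → j < L → f i ≡ f j → i ≡ j) → Unique (map f (range 0 L))
unique-map-range f L inj =
  AllPairs.map⁺ (AllPairs.map (λ (i<j , j<L) fi≡fj → <-irrefl (inj (<-trans i<j j<L) j<L fi≡fj) i<j)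
      (range-ordered 0 L))

xorSum-range-suc : ∀ (f : ℕ → Bool) s k → xorSum (range s k) (f ∘ suc) ≡ xorSum (range (suc s) k) f
xorSum-range-suc f s zero    = refl
xorSum-range-suc f s (suc k) = cong (f (suc s) xor_) (xorSum-range-suc f (suc s) k)

xorSum-range-rotate : ∀ (f : ℕ → Bool) k → f (suc k) ≡ f 0 → xorSum (range 0 (suc k)) (f ∘ suc)
                     ≡ xorSum (range 0 (suc k)) f
xorSum-range-rotate f k f-periodic = begin
  xorSum (range 0 (suc k)) (f ∘ suc)                 ≡⟨ xorSum-range-suc f 0 (suc k) ⟩
  xorSum (range 1 (suc k)) f                         ≡⟨ cong (λ r → xorSum r f) (range-snoc 1 k) ⟩
  xorSum (range 1 k ++ [ suc k ]) f                  ≡⟨ xorSum-++ (range 1 k) [ suc k ] f ⟩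
  xorSum (range 1 k) f xor (f (suc k) xor false)     ≡⟨ cong (λ b → xorSum (range 1 k) f xor (b xor false))
      f-periodic ⟩
  xorSum (range 1 k) f xor (f 0 xor false)           ≡⟨ move-last (xorSum (range 1 k) f) (f 0) ⟩
  f 0 xor xorSum (range 1 k) f                       ∎
  where
  open ≡-Reasoning
  move-last : ∀ a b → a xor (b xor false) ≡ b xor a
  move-last = by-truth-table 2

pairSum-snoc : ∀ xs (x : A) F → pairSum (xs ++ [ x ]) F ≡ pairSum xs F xor xorSum xs (λ y → F y x)
pairSum-snoc []       x F = refl
pairSum-snoc (y ∷ xs) x F = begin
  xorSum (xs ++ [ x ]) (F y) xor pairSum (xs ++ [ x ]) F
    ≡⟨ cong₂ _xor_ (xorSum-++ xs [ x ] (F y)) (pairSum-snoc xs x F) ⟩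
  (xorSum xs (F y) xor (F y x xor false)) xor (pairSum xs F xor xorSum xs (λ z → F z x))
    ≡⟨ regroup (xorSum xs (F y)) (F y x) (pairSum xs F) (xorSum xs (λ z → F z x)) ⟩
  (xorSum xs (F y) xor pairSum xs F) xor (F y x xor xorSum xs (λ z → F z x)) ∎
  where
  open ≡-Reasoning
  regroup : ∀ a b c d → (a xor (b xor false)) xor (c xor d) ≡ (a xor c) xor (b xor d)
  regroup = by-truth-table 4

pairSum-cong-AllPairs : ∀ {R : A → A → Set} {xs} → AllPairs R xs → {F G : A → A → Bool} →
                        (∀ {x y} → R x y → F x y ≡ G x y) → pairSum xs F ≡ pairSum xs G
pairSum-cong-AllPairs {xs = []}     []          F≗G = refl
pairSum-cong-AllPairs {xs = x ∷ xs} (Rx ∷ Rxs) F≗G =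
  cong₂ _xor_ (xorSum-cong-∈ xs (λ y∈ → F≗G (All.lookup Rx y∈))) (pairSum-cong-AllPairs Rxs F≗G)

pairSum-filter : ∀ (w : A → Bool) xs H → pairSum xs (λ x y → (w x ∧ w y) ∧ H x y) ≡ pairSum (filter (T? ∘ w) xs) H
pairSum-filter w []       H = refl
pairSum-filter w (x ∷ xs) H with w x
... | true  = cong₂ _xor_ (xorSum-filter w xs (H x)) (pairSum-filter w xs H)
... | false = cong₂ _xor_ (xorSum-false xs) (pairSum-filter w xs H)

xorSum-square : ∀ xs (F : A → A → Bool) → xorSum xs (λ x → xorSum xs (F x))
               ≡ pairSum xs (λ x y → F x y xor F y x) xor xorSum xs (λ x → F x x)
xorSum-square []       F = refl
xorSum-square (x ∷ xs) F = begin
  (F x x xor xorSum xs (F x)) xor xorSum xs (λ y → F y x xor xorSum xs (F y))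
    ≡⟨ cong ((F x x xor xorSum xs (F x)) xor_)
            (trans (xorSum-xor xs (λ y → F y x) (λ y → xorSum xs (F y)))
                (cong (xorSum xs (λ y → F y x) xor_) (xorSum-square xs F))) ⟩
  (F x x xor xorSum xs (F x)) xor (xorSum xs (λ y → F y x) xor (P xor D))
    ≡⟨ regroup (F x x) (xorSum xs (F x)) (xorSum xs (λ y → F y x)) P D ⟩
  ((xorSum xs (F x) xor xorSum xs (λ y → F y x)) xor P) xor (F x x xor D)
    ≡⟨ cong (λ b → (b xor P) xor (F x x xor D)) (sym (xorSum-xor xs (F x) (λ y → F y x))) ⟩
  (xorSum xs (λ y → F x y xor F y x) xor P) xor (F x x xor D) ∎
  where
  open ≡-Reasoning
  P D : Bool
  P = pairSum xs (λ x y → F x y xor F y x)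
  D = xorSum xs (λ x → F x x)
  regroup : ∀ a b c d e → (a xor b) xor (c xor (d xor e)) ≡ ((b xor c) xor d) xor (a xor e)
  regroup = by-truth-table 5

filter-range-even : (w : ℕ → Bool) → (∀ j → w (suc (suc j)) ≡ w j) → ∀ s p →
                    w s ≡ true → w (suc s) ≡ false → filter (T? ∘ w) (range s (double p)) ≡ everyOther s p
filter-range-even w w-periodic s zero    ws ws′ = refl
filter-range-even w w-periodic s (suc p) ws ws′ rewrite ws | ws′ =
  cong (s ∷_) (filter-range-even w w-periodic (suc (suc s)) p (trans (w-periodic s) ws)
      (trans (w-periodic (suc s)) ws′))

filter-range-odd : (w : ℕ → Bool) → (∀ j → w (suc (suc j)) ≡ w j) → ∀ s p →
                   w s ≡ false → w (suc s) ≡ true → filter (T? ∘ w) (range s (double p)) ≡ everyOther (suc s) p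
filter-range-odd w w-periodic s zero    ws ws′ = refl
filter-range-odd w w-periodic s (suc p) ws ws′ rewrite ws | ws′ =
  cong (suc s ∷_) (filter-range-odd w w-periodic (suc (suc s)) p (trans (w-periodic s) ws)
      (trans (w-periodic (suc s)) ws′))

xorSum-interleave : ∀ (f : ℕ → Bool) s p → xorSum (everyOther s p) f xor xorSum (everyOther (suc s) p) f
                   ≡ xorSum (range s (double p)) f
xorSum-interleave f s zero    = refl
xorSum-interleave f s (suc p) = begin
  (f s xor xorSum (everyOther (2 + s) p) f) xor (f (suc s) xor xorSum (everyOther (3 + s) p) f)
    ≡⟨ regroup (f s) (xorSum (everyOther (2 + s) p) f) (f (suc s)) (xorSum (everyOther (3 + s) p) f) ⟩
  f s xor (f (suc s) xor (xorSum (everyOther (2 + s) p) f xor xorSum (everyOther (3 + s) p) f))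
    ≡⟨ cong (λ b → f s xor (f (suc s) xor b)) (xorSum-interleave f (2 + s) p) ⟩
  f s xor (f (suc s) xor xorSum (range (2 + s) (double p)) f) ∎
  where
  open ≡-Reasoning
  regroup : ∀ a b c d → (a xor b) xor (c xor d) ≡ a xor (c xor (b xor d))
  regroup = by-truth-table 4

xorSum-everyOther-pairs : ∀ (f : ℕ → Bool) s p → xorSum (everyOther s p) (λ j → f j xor f (suc j))
                         ≡ xorSum (range s (double p)) f
xorSum-everyOther-pairs f s zero    = refl
xorSum-everyOther-pairs f s (suc p) =
  trans (cong ((f s xor f (suc s)) xor_) (xorSum-everyOther-pairs f (2 + s) p)) (xor-assoc (f s) (f (suc s)) _)

risingPairs-rotate : ∀ x r → (∀ {y} → y ∈ₗ r → x ≢ y) → risingPairs (x ∷ r) xor risingPairs (r ++ [ x ])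
                    ≡ parity (length r)
risingPairs-rotate x r distinct = begin
  (xorSum r (_>ᵇ x) xor risingPairs r) xor risingPairs (r ++ [ x ])
    ≡⟨ cong ((xorSum r (_>ᵇ x) xor risingPairs r) xor_) (pairSum-snoc r x (λ y z → z >ᵇ y)) ⟩
  (xorSum r (_>ᵇ x) xor risingPairs r) xor (risingPairs r xor xorSum r (x >ᵇ_))
    ≡⟨ cancel (xorSum r (_>ᵇ x)) (risingPairs r) (xorSum r (x >ᵇ_)) ⟩
  xorSum r (_>ᵇ x) xor xorSum r (x >ᵇ_)
    ≡⟨ sym (xorSum-xor r (_>ᵇ x) (x >ᵇ_)) ⟩
  xorSum r (λ y → (y >ᵇ x) xor (x >ᵇ y))
    ≡⟨ xorSum-cong-∈ r (λ y∈ → >ᵇ-xor-flip (distinct y∈ ∘ sym)) ⟩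
  xorSum r (λ _ → true)
    ≡⟨ xorSum-true r ⟩
  parity (length r) ∎
  where
  open ≡-Reasoning
  cancel : ∀ a b c → (a xor b) xor (b xor c) ≡ a xor c
  cancel = by-truth-table 3

risingAt : (ℕ → ℕ) → ℕ → ℕ → Bool
risingAt u j j′ = risingBetween (u j) (u (suc j)) (u j′) (u (suc j′))

pairSum-blocks : ∀ (u : ℕ → ℕ) s p →
                 pairSum (everyOther s p) (risingAt u)
                 ≡ risingPairs (map u (range s (double p))) xor xorSum (everyOther s p) (λ j → u (suc j) >ᵇ u j)
pairSum-blocks u s zero    = refl
pairSum-blocks u s (suc p) = begin
  xorSum (everyOther (2 + s) p) (risingAt u s) xor pairSum (everyOther (2 + s) p) (risingAt u)
    ≡⟨ cong₂ _xor_ outer (pairSum-blocks u (2 + s) p) ⟩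
  (xorSum R (_>ᵇ u s) xor xorSum R (_>ᵇ u (suc s))) xor (risingPairs R xor D)
    ≡⟨ regroup (u (suc s) >ᵇ u s) _ _ _ _ ⟩
  ((u (suc s) >ᵇ u s xor xorSum R (_>ᵇ u s)) xor (xorSum R (_>ᵇ u (suc s)) xor risingPairs R)) xor
      (u (suc s) >ᵇ u s xor D) ∎
  where
  open ≡-Reasoning
  R : List ℕ
  R = map u (range (2 + s) (double p))
  D : Bool
  D = xorSum (everyOther (2 + s) p) (λ j → u (suc j) >ᵇ u j)
  above : ℕ → Bool
  above j = (u j >ᵇ u s) xor (u j >ᵇ u (suc s))
  outer : xorSum (everyOther (2 + s) p) (risingAt u s) ≡ xorSum R (_>ᵇ u s) xor xorSum R (_>ᵇ u (suc s))
  outer = begin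
    xorSum (everyOther (2 + s) p) (risingAt u s)
      ≡⟨ xorSum-cong (everyOther (2 + s) p)
          (λ j → xor-assoc (above j) (u (suc j) >ᵇ u s) (u (suc j) >ᵇ u (suc s))) ⟩
    xorSum (everyOther (2 + s) p) (λ j → above j xor above (suc j))
      ≡⟨ xorSum-everyOther-pairs above (2 + s) p ⟩
    xorSum (range (2 + s) (double p)) above
      ≡⟨ sym (xorSum-map u (range (2 + s) (double p)) (λ y → (y >ᵇ u s) xor (y >ᵇ u (suc s)))) ⟩
    xorSum R (λ y → (y >ᵇ u s) xor (y >ᵇ u (suc s)))
      ≡⟨ xorSum-xor R (_>ᵇ u s) (_>ᵇ u (suc s)) ⟩
    xorSum R (_>ᵇ u s) xor xorSum R (_>ᵇ u (suc s)) ∎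
  regroup : ∀ a b₁ b₂ c d → (b₁ xor b₂) xor (c xor d) ≡ ((a xor b₁) xor (b₂ xor c)) xor (a xor d)
  regroup = by-truth-table 5

module EvenCycle (u : ℕ → ℕ) (q : ℕ) (u-periodic : u (double (suc q)) ≡ u 0)
                 (u-injective : ∀ {i j} → i < double (suc q) → j < double (suc q) → u i ≡ u j → i ≡ j) where

  L : ℕ
  L = double (suc q)

  adjacent-distinct : ∀ {j} → j < L → u j ≢ u (suc j)
  adjacent-distinct {j} j<L uj≡usj with m≤n⇒m<n∨m≡n j<L
  ... | inj₁ sj<L = 1+n≢n (sym (u-injective j<L sj<L uj≡usj))
  ... | inj₂ refl with () ← u-injective j<L z<s (trans uj≡usj u-periodic)

  rotation-odd : risingPairs (map u (range 0 L)) xor risingPairs (map u (range 1 L)) ≡ true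
  rotation-odd = begin
    risingPairs (u 0 ∷ r) xor risingPairs (map u (range 1 L))
      ≡⟨ cong (λ xs → risingPairs (u 0 ∷ r) xor risingPairs xs) shifted ⟩
    risingPairs (u 0 ∷ r) xor risingPairs (r ++ [ u 0 ])
      ≡⟨ risingPairs-rotate (u 0) r distinct ⟩
    parity (length r)
      ≡⟨ cong parity (trans (length-map u (range 1 (suc (double q)))) (length-range 1 (suc (double q)))) ⟩
    not (parity (double q))
      ≡⟨ cong not (parity-double q) ⟩
    true ∎
    where
    open ≡-Reasoning
    r = map u (range 1 (suc (double q)))
    shifted : map u (range 1 L) ≡ r ++ [ u 0 ]
    shifted = begin
      map u (range 1 L)                                  ≡⟨ cong (map u) (range-snoc 1 (suc (double q))) ⟩
      map u (range 1 (suc (double q)) ++ [ L ])          ≡⟨ map-++ u (range 1 (suc (double q))) [ L ] ⟩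
      r ++ [ u L ]                                       ≡⟨ cong (λ x → r ++ [ x ]) u-periodic ⟩
      r ++ [ u 0 ]                                       ∎
    distinct : ∀ {y} → y ∈ₗ r → u 0 ≢ y
    distinct y∈ u0≡y with ∈-map⁻ u y∈
    ... | j , j∈ , refl with ∈-range⁻ 1 (suc (double q)) j∈
    ...   | 0<j , j<L = <-irrefl (u-injective z<s j<L u0≡y) 0<j
  
  ascents-xor-descents : xorSum (range 0 L) (λ j → u (suc j) >ᵇ u j) xor xorSum (range 0 L) (λ j → u j >ᵇ u (suc j))
                        ≡ false
  ascents-xor-descents = begin
    xorSum (range 0 L) (λ j → u (suc j) >ᵇ u j) xor xorSum (range 0 L) (λ j → u j >ᵇ u (suc j))
      ≡⟨ sym (xorSum-xor (range 0 L) (λ j → u (suc j) >ᵇ u j) (λ j → u j >ᵇ u (suc j))) ⟩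
    xorSum (range 0 L) (λ j → (u (suc j) >ᵇ u j) xor (u j >ᵇ u (suc j)))
      ≡⟨ xorSum-cong-∈ (range 0 L) (λ j∈ → >ᵇ-xor-flip (adjacent-distinct (proj₂ (∈-range⁻ 0 L j∈)) ∘ sym)) ⟩
    xorSum (range 0 L) (λ _ → true)
      ≡⟨ xorSum-true (range 0 L) ⟩
    parity (length (range 0 L))
      ≡⟨ cong parity (length-range 0 L) ⟩
    parity L
      ≡⟨ parity-double (suc q) ⟩
    false ∎
    where open ≡-Reasoning

  -- The two pairSum terms are the crossing parities of the two perfect matchings {u₀u₁, u₂u₃, …} and
  -- {u₁u₂, …, u_{L-1}u₀} of the cycle.
  matchings-rising-parity :
    (pairSum (everyOther 0 (suc q)) (risingAt u) xor pairSum (everyOther 1 (suc q)) (risingAt u))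
      xor xorSum (range 0 L) (λ j → u j >ᵇ u (suc j)) ≡ true
  matchings-rising-parity = begin
    (pairSum (everyOther 0 (suc q)) (risingAt u) xor pairSum (everyOther 1 (suc q)) (risingAt u)) xor Desc
      ≡⟨ cong (_xor Desc) (cong₂ _xor_ (pairSum-blocks u 0 (suc q)) (pairSum-blocks u 1 (suc q))) ⟩
    ((risingPairs (map u (range 0 L)) xor X₀) xor (risingPairs (map u (range 1 L)) xor X₁)) xor Desc
      ≡⟨ regroup (risingPairs (map u (range 0 L))) X₀ (risingPairs (map u (range 1 L))) X₁ Desc ⟩
    (risingPairs (map u (range 0 L)) xor risingPairs (map u (range 1 L))) xor ((X₀ xor X₁) xor Desc)
      ≡⟨ cong₂ _xor_ rotation-odd (cong (_xor Desc) (xorSum-interleave (λ j → u (suc j) >ᵇ u j) 0 (suc q))) ⟩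
    true xor (xorSum (range 0 L) (λ j → u (suc j) >ᵇ u j) xor Desc)
      ≡⟨ cong (true xor_) ascents-xor-descents ⟩
    true ∎
    where
    open ≡-Reasoning
    Desc X₀ X₁ : Bool
    Desc = xorSum (range 0 L) (λ j → u j >ᵇ u (suc j))
    X₀ = xorSum (everyOther 0 (suc q)) (λ j → u (suc j) >ᵇ u j)
    X₁ = xorSum (everyOther 1 (suc q)) (λ j → u (suc j) >ᵇ u j)
    regroup : ∀ a x₀ b x₁ d → ((a xor x₀) xor (b xor x₁)) xor d ≡ (a xor b) xor ((x₀ xor x₁) xor d)
    regroup = by-truth-table 5

-- Edge sets and the sign of a 1-factor
module EdgeSets (G : Digraph) where
  open Digraph G

  member : EdgeSet G → Fin m → Bool
  member X e = lookup X e

  ∈⇒member : ∀ {X : EdgeSet G} {e} → e ∈ X → member X e ≡ true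
  ∈⇒member = []=⇒lookup

  member⇒∈ : ∀ {X : EdgeSet G} {e} → member X e ≡ true → e ∈ X
  member⇒∈ {X} {e} = lookup⇒[]= e X

  member-⊕ : ∀ (X Y : EdgeSet G) e → member (_⊕_ G X Y) e ≡ member X e xor member Y e
  member-⊕ X Y e = lookup-zipWith _xor_ e X Y

  member-ext : ∀ {X Y : EdgeSet G} → (∀ e → member X e ≡ member Y e) → X ≡ Y
  member-ext {X} {Y} X≗Y = trans (sym (tabulate∘lookup X)) (trans (tabulate-cong X≗Y) (tabulate∘lookup Y))

  ⊕-cancelʳ : ∀ (X Y : EdgeSet G) → _⊕_ G (_⊕_ G X Y) Y ≡ X
  ⊕-cancelʳ X Y = member-ext λ e → begin
    member (_⊕_ G (_⊕_ G X Y) Y) e           ≡⟨ trans (member-⊕ (_⊕_ G X Y) Y e)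
        (cong (_xor member Y e) (member-⊕ X Y e)) ⟩
    (member X e xor member Y e) xor member Y e ≡⟨ cancel (member X e) (member Y e) ⟩
    member X e                               ∎
    where
    open ≡-Reasoning
    cancel : ∀ x y → (x xor y) xor y ≡ x
    cancel = by-truth-table 2

  ⊆⊕⇒member : ∀ {C X Y : EdgeSet G} → C ⊆ _⊕_ G X Y → ∀ e → member C e ≡ true → member X e xor member Y e ≡ true
  ⊆⊕⇒member {C} {X} {Y} C⊆ e e∈C = trans (sym (member-⊕ X Y e)) (∈⇒member (C⊆ (member⇒∈ e∈C)))

  member⇒⊆⊕ : ∀ {C X Y : EdgeSet G} → (∀ e → member C e ≡ true → member X e xor member Y e ≡ true) → C ⊆ _⊕_ G X Y
  member⇒⊆⊕ {C} {X} {Y} C⊆ {e} e∈C = member⇒∈ (trans (member-⊕ X Y e) (C⊆ e (∈⇒member e∈C)))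

  circuit-nonempty : ∀ {C} → IsCircuit G C → Σ (Fin m) λ e → member C e ≡ true
  circuit-nonempty (t , t-traverses) =
    edge t Fin.zero , ∈⇒member (Equivalence.from (t-traverses (edge t Fin.zero)) (Fin.zero , refl))

  ⊕-⊕-swap : ∀ (X Y Z : EdgeSet G) → _⊕_ G (_⊕_ G X Z) Y ≡ _⊕_ G (_⊕_ G X Y) Z
  ⊕-⊕-swap X Y Z = member-ext λ e → begin
    member (_⊕_ G (_⊕_ G X Z) Y) e           ≡⟨ trans (member-⊕ (_⊕_ G X Z) Y e)
        (cong (_xor member Y e) (member-⊕ X Z e)) ⟩
    (member X e xor member Z e) xor member Y e ≡⟨ swap (member X e) (member Y e) (member Z e) ⟩
    (member X e xor member Y e) xor member Z e ≡⟨ sym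
        (trans (member-⊕ (_⊕_ G X Y) Z e) (cong (_xor member Z e) (member-⊕ X Y e))) ⟩
    member (_⊕_ G (_⊕_ G X Y) Z) e           ∎
    where
    open ≡-Reasoning
    swap : ∀ x y z → (x xor z) xor y ≡ (x xor y) xor z
    swap = by-truth-table 3

  joins⇒incidentˡ : ∀ {e a b} → Joins G e a b → Incident G e a
  joins⇒incidentˡ (inj₁ (p , _)) = inj₁ p
  joins⇒incidentˡ (inj₂ (_ , p)) = inj₂ p

  joins⇒incidentʳ : ∀ {e a b} → Joins G e a b → Incident G e b
  joins⇒incidentʳ (inj₁ (_ , p)) = inj₂ p
  joins⇒incidentʳ (inj₂ (p , _)) = inj₁ p

  incident-joins : ∀ {e a b x} → Joins G e a b → Incident G e x → (x ≡ a) ⊎ (x ≡ b)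
  incident-joins (inj₁ (refl , refl)) (inj₁ refl) = inj₁ refl
  incident-joins (inj₁ (refl , refl)) (inj₂ refl) = inj₂ refl
  incident-joins (inj₂ (refl , refl)) (inj₁ refl) = inj₂ refl
  incident-joins (inj₂ (refl , refl)) (inj₂ refl) = inj₁ refl

  joins-same⇒loop : ∀ {e x} → Joins G e x x → tail e ≡ head e
  joins-same⇒loop (inj₁ (tail≡x , head≡x)) = trans tail≡x (sym head≡x)
  joins-same⇒loop (inj₂ (tail≡x , head≡x)) = trans tail≡x (sym head≡x)

  loop-joins : ∀ {e a b} → tail e ≡ head e → Joins G e a b → a ≡ b
  loop-joins tail≡head (inj₁ (tail≡a , head≡b)) = trans (sym tail≡a) (trans tail≡head head≡b)
  loop-joins tail≡head (inj₂ (tail≡b , head≡a)) = trans (sym head≡a) (trans (sym tail≡head) tail≡b)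

  NoCommonEnd : Fin m → Fin m → Set
  NoCommonEnd e e′ = ∀ x → Incident G e x → Incident G e′ x → ⊥

  oneFactor-unique : ∀ {F : EdgeSet G} → IsOneFactor G F → ∀ {e e′ x} →
                     e ∈ F → e′ ∈ F → Incident G e x → Incident G e′ x → e ≡ e′
  oneFactor-unique oneF {e} {e′} {x} e∈F e′∈F e∋x e′∋x with oneF x
  ... | _ , _ , _ , unique = trans (unique e e∈F e∋x) (sym (unique e′ e′∈F e′∋x))

  oneFactor-noCommonEnd : ∀ {F : EdgeSet G} → IsOneFactor G F → ∀ {e e′} →
                          member F e ≡ true → member F e′ ≡ true → e ≢ e′ → NoCommonEnd e e′
  oneFactor-noCommonEnd oneF e∈F e′∈F e≢e′ x e∋x e′∋x =
    e≢e′ (oneFactor-unique oneF (member⇒∈ e∈F) (member⇒∈ e′∈F) e∋x e′∋x)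

module Sign (G : Digraph) where
  open Digraph G
  open EdgeSets G

  edges : List (Fin m)
  edges = allFin m

  risingEdges : Fin m → Fin m → Bool
  risingEdges e e′ = risingBetween (toℕ (tail e)) (toℕ (head e)) (toℕ (tail e′)) (toℕ (head e′))

  crossing : Fin m → Fin m → Bool
  crossing e e′ = (toℕ e′ >ᵇ toℕ e) ∧ risingEdges e e′

  reversed : Fin m → Bool
  reversed e = toℕ (tail e) >ᵇ toℕ (head e)

  crossingsBetween : (Fin m → Bool) → (Fin m → Bool) → Bool
  crossingsBetween X Y = xorSum edges (λ e → X e ∧ xorSum edges (λ e′ → Y e′ ∧ crossing e e′))

  crossings : (Fin m → Bool) → Bool
  crossings X = crossingsBetween X X

  reversals : (Fin m → Bool) → Bool
  reversals X = xorSum edges (λ e → X e ∧ reversed e)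

  -- The parity of the inversions of the word  tail e₁ head e₁ tail e₂ head e₂ ⋯  over the edges e₁ < e₂ < ⋯
  -- of X (between two edges, rising and inverted pairs have equal parity): for a 1-factor, the sign of its
  -- term in the Pfaffian.
  sign : EdgeSet G → Bool
  sign X = crossings (member X) xor reversals (member X)

  risingEdges-swap : ∀ {e e′} → NoCommonEnd e e′ → risingEdges e e′ ≡ risingEdges e′ e
  risingEdges-swap {e} {e′} apart = risingBetween-swap
    (λ eq → apart (tail e) (inj₁ refl) (inj₁ (sym (toℕ-injective eq))))
    (λ eq → apart (tail e) (inj₁ refl) (inj₂ (sym (toℕ-injective eq))))
    (λ eq → apart (head e) (inj₂ refl) (inj₁ (sym (toℕ-injective eq))))
    (λ eq → apart (head e) (inj₂ refl) (inj₂ (sym (toℕ-injective eq))))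

  crossing-pair : ∀ {e e′} → e ≢ e′ → NoCommonEnd e e′ → crossing e e′ xor crossing e′ e ≡ risingEdges e e′
  crossing-pair {e} {e′} e≢e′ apart rewrite sym (risingEdges-swap apart) =
    trans (sym (∧-distribʳ-xor (risingEdges e e′) (toℕ e′ >ᵇ toℕ e) (toℕ e >ᵇ toℕ e′)))
          (cong (_∧ risingEdges e e′) (>ᵇ-xor-flip (λ eq → e≢e′ (toℕ-injective (sym eq)))))

  crossing-irrefl : ∀ e → crossing e e ≡ false
  crossing-irrefl e rewrite >ᵇ-irrefl (toℕ e) = refl

  risingEdges-joins : ∀ {e e′ a b c d} → Joins G e a b → Joins G e′ c d →
                      risingEdges e e′ ≡ risingBetween (toℕ a) (toℕ b) (toℕ c) (toℕ d)
  risingEdges-joins (inj₁ (refl , refl)) (inj₁ (refl , refl)) = refl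
  risingEdges-joins {e} {e′} (inj₁ (refl , refl)) (inj₂ (refl , refl)) =
    risingBetween-swapʳ (toℕ (tail e)) (toℕ (head e)) (toℕ (tail e′)) (toℕ (head e′))
  risingEdges-joins {e} {e′} (inj₂ (refl , refl)) (inj₁ (refl , refl)) =
    risingBetween-swapˡ (toℕ (tail e)) (toℕ (head e)) (toℕ (tail e′)) (toℕ (head e′))
  risingEdges-joins {e} {e′} (inj₂ (refl , refl)) (inj₂ (refl , refl)) =
    trans (risingBetween-swapˡ (toℕ (tail e)) (toℕ (head e)) (toℕ (tail e′)) (toℕ (head e′)))
          (risingBetween-swapʳ (toℕ (head e)) (toℕ (tail e)) (toℕ (tail e′)) (toℕ (head e′)))

  crossings-cong : ∀ {X Y : Fin m → Bool} → (∀ e → X e ≡ Y e) → crossings X ≡ crossings Y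
  crossings-cong X≗Y =
    xorSum-cong edges (λ e → cong₂ _∧_ (X≗Y e) (xorSum-cong edges (λ e′ → cong (_∧ crossing e e′) (X≗Y e′))))

  reversals-cong : ∀ {X Y : Fin m → Bool} → (∀ e → X e ≡ Y e) → reversals X ≡ reversals Y
  reversals-cong X≗Y = xorSum-cong edges (λ e → cong (_∧ reversed e) (X≗Y e))

  reversals-xor : ∀ (X Y : Fin m → Bool) → reversals (λ e → X e xor Y e) ≡ reversals X xor reversals Y
  reversals-xor X Y = trans (xorSum-cong edges (λ e → ∧-distribʳ-xor (reversed e) (X e) (Y e)))
      (xorSum-xor edges _ _)

  crossings-xor : ∀ (X Y : Fin m → Bool) →
                  crossings (λ e → X e xor Y e) ≡ (crossings X xor crossings Y) xor
                      (crossingsBetween X Y xor crossingsBetween Y X)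
  crossings-xor X Y = begin
    crossings (λ e → X e xor Y e)
      ≡⟨ xorSum-cong edges (λ e → cong ((X e xor Y e) ∧_) (inner e)) ⟩
    xorSum edges (λ e → (X e xor Y e) ∧ (I X e xor I Y e))
      ≡⟨ xorSum-cong edges (λ e → expand (X e) (Y e) (I X e) (I Y e)) ⟩
    xorSum edges (λ e → ((X e ∧ I X e) xor (Y e ∧ I Y e)) xor ((X e ∧ I Y e) xor (Y e ∧ I X e)))
      ≡⟨ xorSum-xor edges _ _ ⟩
    xorSum edges (λ e → (X e ∧ I X e) xor (Y e ∧ I Y e)) xor xorSum edges (λ e → (X e ∧ I Y e) xor (Y e ∧ I X e))
      ≡⟨ cong₂ _xor_ (xorSum-xor edges _ _) (xorSum-xor edges _ _) ⟩
    (crossings X xor crossings Y) xor (crossingsBetween X Y xor crossingsBetween Y X) ∎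
    where
    open ≡-Reasoning
    I : (Fin m → Bool) → Fin m → Bool
    I Z e = xorSum edges (λ e′ → Z e′ ∧ crossing e e′)
    inner : ∀ e → xorSum edges (λ e′ → (X e′ xor Y e′) ∧ crossing e e′) ≡ I X e xor I Y e
    inner e = trans (xorSum-cong edges (λ e′ → ∧-distribʳ-xor (crossing e e′) (X e′) (Y e′)))
        (xorSum-xor edges _ _)
    expand : ∀ x y ix iy → (x xor y) ∧ (ix xor iy) ≡ ((x ∧ ix) xor (y ∧ iy)) xor ((x ∧ iy) xor (y ∧ ix))
    expand = by-truth-table 4

  crossingsBetween-sym : ∀ (X Y : Fin m → Bool) →
    crossingsBetween X Y xor crossingsBetween Y X
      ≡ xorSum edges (λ e → X e ∧ xorSum edges (λ e′ → Y e′ ∧ (crossing e e′ xor crossing e′ e)))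
  crossingsBetween-sym X Y = begin
    crossingsBetween X Y xor crossingsBetween Y X
      ≡⟨ cong₂ _xor_ (xorSum-cong edges (λ e → sym (xorSum-∧ˡ edges (X e) (λ e′ → Y e′ ∧ crossing e e′))))
                     (trans (xorSum-cong edges (λ e → sym (xorSum-∧ˡ edges (Y e) (λ e′ → X e′ ∧ crossing e e′))))
                            (xorSum-comm edges edges (λ e e′ → Y e ∧ (X e′ ∧ crossing e e′)))) ⟩
    xorSum edges (λ e → xorSum edges (λ e′ → X e ∧ (Y e′ ∧ crossing e e′)))
      xor xorSum edges (λ e → xorSum edges (λ e′ → Y e′ ∧ (X e ∧ crossing e′ e)))
      ≡⟨ sym (xorSum-xor edges _ _) ⟩
    xorSum edges (λ e → xorSum edges (λ e′ → X e ∧ (Y e′ ∧ crossing e e′)) xor xorSum edges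
        (λ e′ → Y e′ ∧ (X e ∧ crossing e′ e)))
      ≡⟨ xorSum-cong edges (λ e → sym (xorSum-xor edges _ _)) ⟩
    xorSum edges (λ e → xorSum edges (λ e′ → (X e ∧ (Y e′ ∧ crossing e e′)) xor (Y e′ ∧ (X e ∧ crossing e′ e))))
      ≡⟨ xorSum-cong edges (λ e → xorSum-cong edges (λ e′ → factor (X e) (Y e′) (crossing e e′) (crossing e′ e))) ⟩
    xorSum edges (λ e → xorSum edges (λ e′ → X e ∧ (Y e′ ∧ (crossing e e′ xor crossing e′ e))))
      ≡⟨ xorSum-cong edges (λ e → xorSum-∧ˡ edges (X e) _) ⟩
    xorSum edges (λ e → X e ∧ xorSum edges (λ e′ → Y e′ ∧ (crossing e e′ xor crossing e′ e))) ∎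
    where
    open ≡-Reasoning
    factor : ∀ x y a b → (x ∧ (y ∧ a)) xor (y ∧ (x ∧ b)) ≡ x ∧ (y ∧ (a xor b))
    factor = by-truth-table 4

-- Circuits as periodic sequences
module Cycles (G : Digraph) where
  open Digraph G
  open EdgeSets G

  -- A traversal of the circuit C indexed by ℕ and periodic with period L, so that position j is followed by suc j.
  record Cycle (C : EdgeSet G) (L : ℕ) : Set where
    field
      V : ℕ → Fin n
      E : ℕ → Fin m
      V-periodic  : V L ≡ V 0
      E-periodic  : E L ≡ E 0
      E-joins     : ∀ {j} → j < L → Joins G (E j) (V j) (V (suc j))
      V-injective : ∀ {i j} → i < L → j < L → V i ≡ V j → i ≡ j
      E-injective : ∀ {i j} → i < L → j < L → E i ≡ E j → i ≡ j
      E-onto      : ∀ e → member C e ≡ true → Σ ℕ λ j → j < L × E j ≡ e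
      E-∈         : ∀ {j} → j < L → member C (E j) ≡ true

    agreement : Bool
    agreement = xorSum (range 0 L) (λ j → ⌊ tail (E j) ≟ V j ⌋)

  module FromTraversal (t : Traversal G) {C : EdgeSet G} (t-traverses : Traverses G t C) where
    L : ℕ
    L = suc (suc (len t))

    index : ℕ → Fin L
    index j = fromℕ< (m%n<n j L)

    toℕ-index : ∀ j → toℕ (index j) ≡ j % L
    toℕ-index j = toℕ-fromℕ< (m%n<n j L)

    toℕ-index-< : ∀ {j} → j < L → toℕ (index j) ≡ j
    toℕ-index-< {j} j<L = trans (toℕ-index j) (m<n⇒m%n≡m j<L)

    index-toℕ : ∀ (k : Fin L) → index (toℕ k) ≡ k
    index-toℕ k = toℕ-injective (toℕ-index-< (toℕ<n k))

    index-injective : ∀ {i j} → i < L → j < L → index i ≡ index j → i ≡ j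
    index-injective i<L j<L eq = trans (sym (toℕ-index-< i<L)) (trans (cong toℕ eq) (toℕ-index-< j<L))

    next-index : ∀ j → next G (index j) ≡ index (suc j)
    next-index j = toℕ-injective (begin
      toℕ (next G (index j))            ≡⟨ toℕ-fromℕ< (m%n<n (suc (toℕ (index j))) L) ⟩
      suc (toℕ (index j)) % L           ≡⟨ cong (λ k → suc k % L) (toℕ-index j) ⟩
      (1 + j % L) % L                   ≡⟨ %-distribˡ-+ 1 (j % L) L ⟩
      (1 % L + j % L % L) % L           ≡⟨ cong (λ k → (1 % L + k) % L) (m%n%n≡m%n j L) ⟩
      (1 % L + j % L) % L               ≡⟨ sym (%-distribˡ-+ 1 j L) ⟩
      suc j % L                         ≡⟨ sym (toℕ-index (suc j)) ⟩
      toℕ (index (suc j))               ∎)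
      where open ≡-Reasoning

    index-periodic : index L ≡ index 0
    index-periodic = toℕ-injective (trans (toℕ-index L) (trans (n%n≡0 L) (sym (toℕ-index 0))))

    cycle : Cycle C L
    cycle = record
      { V           = λ j → vert t (index j)
      ; E           = λ j → edge t (index j)
      ; V-periodic  = cong (vert t) index-periodic
      ; E-periodic  = cong (edge t) index-periodic
      ; E-joins     = λ {j} _ → subst (Joins G (edge t (index j)) (vert t (index j)) ∘′ vert t) (next-index j)
          (joins t (index j))
      ; V-injective = λ i<L j<L eq → index-injective i<L j<L (vert-inj t _ _ eq)
      ; E-injective = λ i<L j<L eq → index-injective i<L j<L (edge-inj t _ _ eq)
      ; E-onto      = λ e e∈C → onto e (Equivalence.to (t-traverses e) (member⇒∈ e∈C))
      ; E-∈         = λ {j} _ → ∈⇒member (Equivalence.from (t-traverses (edge t (index j))) (index j , refl))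
      }
      where
      onto : ∀ e → (Σ (Fin L) λ k → edge t k ≡ e) → Σ ℕ λ j → j < L × edge t (index j) ≡ e
      onto e (k , refl) = toℕ k , toℕ<n k , cong (edge t) (index-toℕ k)

    parity-agreements : parity (agreements t) ≡ Cycle.agreement cycle
    parity-agreements = begin
      parity (agreements t)                 ≡⟨ parity-sum-indicator (allFin L) agrees ⟩
      xorSum (allFin L) agrees              ≡⟨ xorSum-↭
          (unique-same-members-↭ (allFin⁺ L) (unique-map-range index L index-injective) same) agrees ⟩
      xorSum (map index (range 0 L)) agrees ≡⟨ xorSum-map index (range 0 L) agrees ⟩
      Cycle.agreement cycle                 ∎
      where
      open ≡-Reasoning
      agrees : Fin L → Bool
      agrees k = ⌊ tail (edge t k) ≟ vert t k ⌋
      same : ∀ {k} → k ∈ₗ allFin L ⇔ k ∈ₗ map index (range 0 L)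
      same {k} = mk⇔ (λ _ → subst (_∈ₗ map index (range 0 L)) (index-toℕ k)
          (∈-map⁺ index (∈-range⁺ 0 L z≤n (toℕ<n k))))
                     (λ _ → ∈-allFin k)

  module CycleFacts {C : EdgeSet G} {l : ℕ} (cy : Cycle C (suc (suc l))) where
    open Cycle cy

    L : ℕ
    L = suc (suc l)

    prev : ℕ → ℕ
    prev zero    = suc l
    prev (suc k) = k

    prev-< : ∀ {i} → i < L → prev i < L
    prev-< {zero}  _         = ≤-refl
    prev-< {suc k} (s≤s k<L) = m≤n⇒m≤1+n k<L

    V-prev : ∀ i → V (suc (prev i)) ≡ V i
    V-prev zero    = V-periodic
    V-prev (suc k) = refl

    E-prev : ∀ i → E (suc (prev i)) ≡ E i
    E-prev zero    = E-periodic
    E-prev (suc k) = refl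

    E-incident : ∀ {i} → i < L → Incident G (E i) (V i)
    E-incident i<L = joins⇒incidentˡ (E-joins i<L)

    E-prev-incident : ∀ {i} → i < L → Incident G (E (prev i)) (V i)
    E-prev-incident {i} i<L = subst (Incident G (E (prev i))) (V-prev i) (joins⇒incidentʳ (E-joins (prev-< i<L)))

    next-edge : ∀ {j} → j < L → Incident G (E (suc j)) (V (suc j)) × member C (E (suc j)) ≡ true × E (suc j) ≢ E j
    next-edge {j} j<L with m≤n⇒m<n∨m≡n j<L
    ... | inj₁ sj<L = E-incident sj<L , E-∈ sj<L , 1+n≢n ∘′ E-injective sj<L j<L
    ... | inj₂ refl = subst₂ (Incident G) (sym E-periodic) (sym V-periodic) (E-incident z<s)
                    , subst (λ e → member C e ≡ true) (sym E-periodic) (E-∈ z<s)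
                    , (λ ()) ∘′ E-injective z<s j<L ∘′ trans (sym E-periodic)

    cycle-edges-at : ∀ {i e} → i < L → member C e ≡ true → Incident G e (V i) → (e ≡ E i) ⊎ (e ≡ E (prev i))
    cycle-edges-at {i} i<L e∈C e∋Vi with E-onto _ e∈C
    ... | j , j<L , refl with incident-joins (E-joins j<L) e∋Vi
    ...   | inj₁ Vi≡Vj = inj₁ (cong E (V-injective j<L i<L (sym Vi≡Vj)))
    ...   | inj₂ Vi≡Vsj with m≤n⇒m<n∨m≡n j<L
    ...     | inj₁ sj<L = inj₂ (cong (E ∘′ prev) (V-injective sj<L i<L (sym Vi≡Vsj)))
    ...     | inj₂ refl = inj₂ (cong (E ∘′ prev) (sym (V-injective i<L z<s (trans Vi≡Vsj V-periodic))))

    endpoint-on-cycle : ∀ {e x} → member C e ≡ true → Incident G e x → Σ ℕ λ i → i < L × V i ≡ x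
    endpoint-on-cycle {e} e∈C e∋x with E-onto e e∈C
    ... | j , j<L , refl with incident-joins (E-joins j<L) e∋x
    ...   | inj₁ x≡Vj = j , j<L , sym x≡Vj
    ...   | inj₂ x≡Vsj with m≤n⇒m<n∨m≡n j<L
    ...     | inj₁ sj<L = suc j , sj<L , sym x≡Vsj
    ...     | inj₂ refl = 0 , z<s , trans (sym V-periodic) (sym x≡Vsj)

    V-adjacent-distinct : ∀ {j} → j < L → V j ≢ V (suc j)
    V-adjacent-distinct {j} j<L eq with m≤n⇒m<n∨m≡n j<L
    ... | inj₁ sj<L = 1+n≢n (sym (V-injective j<L sj<L eq))
    ... | inj₂ refl with () ← V-injective j<L z<s (trans eq V-periodic)

    no-loops : ∀ {e} → member C e ≡ true → tail e ≢ head e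
    no-loops {e} e∈C tail≡head with E-onto e e∈C
    ... | j , j<L , refl = V-adjacent-distinct j<L (loop-joins tail≡head (E-joins j<L))

    on-cycle? : ∀ x → (Σ ℕ λ i → i < L × V i ≡ x) ⊎ (∀ {e} → member C e ≡ true → ¬ Incident G e x)
    on-cycle? x with Any.any? (λ i → V i ≟ x) (range 0 L)
    ... | yes found = let i , i∈ , Vi≡x = find found in inj₁ (i , proj₂ (∈-range⁻ 0 L i∈) , Vi≡x)
    ... | no none   = inj₂ λ e∈C e∋x → let i , i<L , Vi≡x = endpoint-on-cycle e∈C e∋x in
                                        none (lose (∈-range⁺ 0 L z≤n i<L) Vi≡x)

    xorSum-cycle : ∀ h → xorSum (allFin m) (λ e → member C e ∧ h e) ≡ xorSum (range 0 L) (h ∘′ E)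
    xorSum-cycle h = begin
      xorSum (allFin m) (λ e → member C e ∧ h e)  ≡⟨ xorSum-filter (member C) (allFin m) h ⟩
      xorSum (filter (T? ∘ member C) (allFin m)) h ≡⟨ xorSum-↭
          (unique-same-members-↭ (filter⁺ _ (allFin⁺ m)) (unique-map-range E L E-injective) same) h ⟩
      xorSum (map E (range 0 L)) h                ≡⟨ xorSum-map E (range 0 L) h ⟩
      xorSum (range 0 L) (h ∘′ E)                 ∎
      where
      open ≡-Reasoning
      same : ∀ {e} → e ∈ₗ filter (T? ∘ member C) (allFin m) ⇔ e ∈ₗ map E (range 0 L)
      same {e} = mk⇔
        (λ e∈ → let j , j<L , Ej≡e = E-onto e (Equivalence.to T-≡ (proj₂ (∈-filter⁻ (T? ∘ member C) {xs = allFin m} e∈))) in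
                subst (_∈ₗ map E (range 0 L)) Ej≡e (∈-map⁺ E (∈-range⁺ 0 L z≤n j<L)))
        (λ e∈ → let j , j∈ , e≡Ej = ∈-map⁻ E e∈ in
                ∈-filter⁺ (T? ∘ member C) (∈-allFin e)
                    (Equivalence.from T-≡ (subst (λ e → member C e ≡ true) (sym e≡Ej)
                        (E-∈ (proj₂ (∈-range⁻ 0 L j∈))))))

    module Alternating {F₁ F₂ : EdgeSet G} (one₁ : IsOneFactor G F₁) (one₂ : IsOneFactor G F₂)
                       (C⊆F₁⊕F₂ : ∀ e → member C e ≡ true → member F₁ e xor member F₂ e ≡ true) where

      ∉F₁⇒∈F₂ : ∀ {e} → member C e ≡ true → member F₁ e ≡ false → e ∈ F₂
      ∉F₁⇒∈F₂ {e} e∈C e∉F₁ = member⇒∈ (trans (cong (_xor member F₂ e) (sym e∉F₁)) (C⊆F₁⊕F₂ e e∈C))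

      alternates : ∀ {j} → j < L → member F₁ (E (suc j)) ≡ not (member F₁ (E j))
      alternates {j} j<L with member F₁ (E j) in Ej∈? | member F₁ (E (suc j)) in Esj∈? | next-edge j<L
      ... | false | true  | _ = refl
      ... | true  | false | _ = refl
      ... | true  | true  | Esj∋ , _ , Esj≢Ej = ⊥-elim (Esj≢Ej
        (oneFactor-unique one₁ (member⇒∈ Esj∈?) (member⇒∈ Ej∈?) Esj∋ (joins⇒incidentʳ (E-joins j<L))))
      ... | false | false | Esj∋ , Esj∈C , Esj≢Ej = ⊥-elim (Esj≢Ej
        (oneFactor-unique one₂ (∉F₁⇒∈F₂ Esj∈C Esj∈?) (∉F₁⇒∈F₂ (E-∈ j<L) Ej∈?) Esj∋ (joins⇒incidentʳ (E-joins j<L))))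

      F₁-pattern : ∀ {j} → j ≤ L → member F₁ (E j) ≡ member F₁ (E 0) xor parity j
      F₁-pattern {zero}  _      = sym (xor-identityʳ _)
      F₁-pattern {suc j} sj≤L = trans (alternates sj≤L)
        (trans (cong not (F₁-pattern (m≤n⇒m≤1+n (≤-pred sj≤L)))) (not-distribʳ-xor (member F₁ (E 0)) (parity j)))

      even-length : parity L ≡ false
      even-length = parity≡false (member F₁ (E 0)) (trans (cong (member F₁) (sym E-periodic)) (F₁-pattern ≤-refl))
        where
        parity≡false : ∀ a {b} → a ≡ a xor b → b ≡ false
        parity≡false false {b}     eq = sym eq
        parity≡false true  {false} eq = refl

    module Swap {M : EdgeSet G} (oneM : IsOneFactor G M)
                (M-alternates : ∀ {j} → j < L → member M (E (suc j)) ≡ not (member M (E j))) where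

      M-prev : ∀ {i} → i < L → member M (E (prev i)) ≡ not (member M (E i))
      M-prev {i} i<L = trans (sym (not-involutive _))
        (cong not (trans (sym (M-alternates (prev-< i<L))) (cong (member M) (E-prev i))))

      ∈⊕ : ∀ {e a b} → member M e ≡ a → member C e ≡ b → a xor b ≡ true → e ∈ _⊕_ G M C
      ∈⊕ {e} refl refl ab = member⇒∈ (trans (member-⊕ M C e) ab)

      ⊕-member : ∀ {e} → e ∈ _⊕_ G M C → member M e xor member C e ≡ true
      ⊕-member {e} e∈ = trans (sym (member-⊕ M C e)) (∈⇒member e∈)

      unique-⊕-edge : ∀ {x a b} → member C a ≡ true → member C b ≡ true → Incident G a x →
                      member M a ≡ true → member M b ≡ false →
                      (∀ {e} → member C e ≡ true → Incident G e x → (e ≡ a) ⊎ (e ≡ b)) →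
                      ∀ e → e ∈ _⊕_ G M C → Incident G e x → e ≡ b
      unique-⊕-edge {x} {a} a∈C b∈C a∋x a∈M b∉M cycle-pair e e∈ e∋x with member C e in e∈C?
      ... | true with cycle-pair e∈C? e∋x
      ...   | inj₂ e≡b  = e≡b
      ...   | inj₁ refl with () ← trans (sym (cong₂ _xor_ a∈M e∈C?)) (⊕-member e∈)
      unique-⊕-edge {x} {a} a∈C b∈C a∋x a∈M b∉M cycle-pair e e∈ e∋x | false with () ←
        trans (sym a∈C) (trans (cong (member C) (oneFactor-unique oneM (member⇒∈ a∈M)
          (member⇒∈ (xor≡true∧false⇒true (⊕-member e∈) e∈C?)) a∋x e∋x)) e∈C?)

      swap-at-cycle : ∀ {i} → i < L → Σ (Fin m) λ e → e ∈ _⊕_ G M C × Incident G e (V i) ×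
                                        (∀ e′ → e′ ∈ _⊕_ G M C → Incident G e′ (V i) → e′ ≡ e)
      swap-at-cycle {i} i<L with member M (E i) in Ei∈M?
      ... | true  = E (prev i) , ∈⊕ Eprev∈M? (E-∈ (prev-< i<L)) refl , E-prev-incident i<L
                  , unique-⊕-edge (E-∈ i<L) (E-∈ (prev-< i<L)) (E-incident i<L) Ei∈M? Eprev∈M? (cycle-edges-at i<L)
        where
        Eprev∈M? : member M (E (prev i)) ≡ false
        Eprev∈M? = trans (M-prev i<L) (cong not Ei∈M?)
      ... | false = E i , ∈⊕ Ei∈M? (E-∈ i<L) refl , E-incident i<L
                  , unique-⊕-edge (E-∈ (prev-< i<L)) (E-∈ i<L) (E-prev-incident i<L) Eprev∈M? Ei∈M?
                                  (λ e∈C e∋Vi → Sum.swap (cycle-edges-at i<L e∈C e∋Vi))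
        where
        Eprev∈M? : member M (E (prev i)) ≡ true
        Eprev∈M? = trans (M-prev i<L) (cong not Ei∈M?)

      swap-oneFactor : IsOneFactor G (_⊕_ G M C)
      swap-oneFactor x with on-cycle? x
      ... | inj₁ (i , i<L , refl) = swap-at-cycle i<L
      ... | inj₂ off with oneM x
      ...   | d , d∈M , d∋x , uniqueM =
        d , ∈⊕ (∈⇒member d∈M) (∉C d∋x) refl , d∋x ,
        λ e e∈ e∋x → uniqueM e (member⇒∈ (xor≡true∧false⇒true (⊕-member e∈) (∉C e∋x))) e∋x
        where
        ∉C : ∀ {e} → Incident G e x → member C e ≡ false
        ∉C {e} e∋x with member C e in e∈C?
        ... | false = refl
        ... | true  = ⊥-elim (off e∈C? e∋x)

  circuit-loopless : ∀ {C} → IsCircuit G C → ∀ {e} → member C e ≡ true → tail e ≢ head e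
  circuit-loopless (t , t-traverses) = CycleFacts.no-loops (FromTraversal.cycle t t-traverses)

-- Swapping a 1-factor along an alternating circuit
module SwapAlongCycle (G : Digraph) where
  open Digraph G
  open EdgeSets G
  open Sign G
  open Cycles G

  module _ {M C : EdgeSet G} (oneM : IsOneFactor G M) (oneM⊕C : IsOneFactor G (_⊕_ G M C))
           {q : ℕ} (cy : Cycle C (double (suc q)))
           (M-pattern : ∀ {j} → j < double (suc q) → member M (Cycle.E cy j) ≡ not (parity j)) where
    open Cycle cy
    open CycleFacts cy using (L; xorSum-cycle; endpoint-on-cycle)

    u : ℕ → ℕ
    u j = toℕ (V j)

    open EvenCycle u q (cong toℕ V-periodic) (λ i<L j<L eq → V-injective i<L j<L (toℕ-injective eq))
      using (adjacent-distinct; matchings-rising-parity)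

    M-edge-at : ∀ {i} → i < L → Σ ℕ λ k → k < L × member M (E k) ≡ true × Incident G (E k) (V i)
    M-edge-at {i} i<L with parity i in parity-i
    ... | false = i , i<L , trans (M-pattern i<L) (cong not parity-i) , joins⇒incidentˡ (E-joins i<L)
    M-edge-at {suc i} si<L | true =
      i , <⇒≤ si<L , trans (M-pattern (<⇒≤ si<L)) parity-i , joins⇒incidentʳ (E-joins (<⇒≤ si<L))

    -- M already covers every vertex of the cycle by a cycle edge.
    off-cycle-M-edge-apart : ∀ {e e′} → member M e ≡ true → member C e ≡ false → member C e′ ≡ true →
        NoCommonEnd e e′
    off-cycle-M-edge-apart {e} {e′} e∈M e∉C e′∈C x e∋x e′∋x with endpoint-on-cycle e′∈C e′∋x
    ... | i , i<L , refl with M-edge-at i<L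
    ...   | k , k<L , Ek∈M , Ek∋Vi with () ←
      trans (sym (E-∈ k<L)) (trans (cong (member C) (oneFactor-unique oneM (member⇒∈ Ek∈M) (member⇒∈ e∈M) Ek∋Vi e∋x)) e∉C)

    crossings-on-cycle : (W : Fin m → Bool) (w : ℕ → Bool) → (∀ {j} → j < L → W (E j) ≡ w j) →
      (∀ {e e′} → W e ≡ true → member C e ≡ true → W e′ ≡ true → member C e′ ≡ true → e ≢ e′ → NoCommonEnd e e′) →
      crossings (λ e → W e ∧ member C e) ≡ pairSum (filter (T? ∘ w) (range 0 L)) (risingAt u)
    crossings-on-cycle W w W≗w apart = begin
      xorSum edges (λ e → (W e ∧ member C e) ∧ xorSum edges (λ e′ → (W e′ ∧ member C e′) ∧ crossing e e′))
        ≡⟨ xorSum-cong edges (λ e → cong ((W e ∧ member C e) ∧_)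
             (trans (xorSum-cong edges (λ e′ → ∧-rearrange (W e′) (member C e′) (crossing e e′)))
                 (xorSum-cycle (λ e′ → W e′ ∧ crossing e e′)))) ⟩
      xorSum edges (λ e → (W e ∧ member C e) ∧ xorSum (range 0 L) (λ j′ → W (E j′) ∧ crossing e (E j′)))
        ≡⟨ xorSum-cong edges (λ e → ∧-rearrange (W e) (member C e) _) ⟩
      xorSum edges (λ e → member C e ∧ (W e ∧ xorSum (range 0 L) (λ j′ → W (E j′) ∧ crossing e (E j′))))
        ≡⟨ xorSum-cycle _ ⟩
      xorSum (range 0 L) (λ j → W (E j) ∧ xorSum (range 0 L) (λ j′ → W (E j′) ∧ crossing (E j) (E j′)))
        ≡⟨ xorSum-cong (range 0 L) (λ j → sym (xorSum-∧ˡ (range 0 L) (W (E j)) _)) ⟩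
      xorSum (range 0 L) (λ j → xorSum (range 0 L) (F j))
        ≡⟨ xorSum-square (range 0 L) F ⟩
      pairSum (range 0 L) (λ j j′ → F j j′ xor F j′ j) xor xorSum (range 0 L) (λ j → F j j)
        ≡⟨ cong₂ _xor_ (pairSum-cong-AllPairs (range-ordered 0 L) pair)
                       (trans (xorSum-cong (range 0 L) diagonal) (xorSum-false (range 0 L))) ⟩
      pairSum (range 0 L) (λ j j′ → (w j ∧ w j′) ∧ risingAt u j j′) xor false
        ≡⟨ xor-comm _ false ⟩
      pairSum (range 0 L) (λ j j′ → (w j ∧ w j′) ∧ risingAt u j j′)
        ≡⟨ pairSum-filter w (range 0 L) (risingAt u) ⟩
      pairSum (filter (T? ∘ w) (range 0 L)) (risingAt u) ∎
      where
      open ≡-Reasoning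
      ∧-rearrange : ∀ a c k → (a ∧ c) ∧ k ≡ c ∧ (a ∧ k)
      ∧-rearrange = by-truth-table 3
      F : ℕ → ℕ → Bool
      F j j′ = W (E j) ∧ (W (E j′) ∧ crossing (E j) (E j′))
      diagonal : ∀ j → F j j ≡ false
      diagonal j rewrite crossing-irrefl (E j) = absorb (W (E j))
        where
        absorb : ∀ b → b ∧ (b ∧ false) ≡ false
        absorb = by-truth-table 1
      pair : ∀ {j j′} → j < j′ × j′ < L → F j j′ xor F j′ j ≡ (w j ∧ w j′) ∧ risingAt u j j′
      pair {j} {j′} (j<j′ , j′<L) = begin
        F j j′ xor F j′ j
          ≡⟨ factor (W (E j)) (W (E j′)) (crossing (E j) (E j′)) (crossing (E j′) (E j)) ⟩
        (W (E j) ∧ W (E j′)) ∧ (crossing (E j) (E j′) xor crossing (E j′) (E j))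
          ≡⟨ when-both-true (W (E j)) (W (E j′)) (λ Wj Wj′ →
               trans (crossing-pair Ej≢Ej′ (apart Wj (E-∈ j<L) Wj′ (E-∈ j′<L) Ej≢Ej′))
                   (risingEdges-joins (E-joins j<L) (E-joins j′<L))) ⟩
        (W (E j) ∧ W (E j′)) ∧ risingAt u j j′
          ≡⟨ cong₂ (λ a b → (a ∧ b) ∧ risingAt u j j′) (W≗w j<L) (W≗w j′<L) ⟩
        (w j ∧ w j′) ∧ risingAt u j j′ ∎
        where
        j<L : j < L
        j<L = <-trans j<j′ j′<L
        Ej≢Ej′ : E j ≢ E j′
        Ej≢Ej′ eq = <-irrefl (E-injective j<L j′<L eq) j<j′
        factor : ∀ a b k₁ k₂ → (a ∧ (b ∧ k₁)) xor (b ∧ (a ∧ k₂)) ≡ (a ∧ b) ∧ (k₁ xor k₂)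
        factor = by-truth-table 4

    -- Telescoping around the cycle, where φ x is the parity of the number of endpoints of e below x.
    crossings-with-cycle-vanish : ∀ {e} → member C e ≡ false → (∀ {e′} → member C e′ ≡ true → NoCommonEnd e e′) →
      xorSum edges (λ e′ → member C e′ ∧ (crossing e e′ xor crossing e′ e)) ≡ false
    crossings-with-cycle-vanish {e} e∉C apart = begin
      xorSum edges (λ e′ → member C e′ ∧ (crossing e e′ xor crossing e′ e))
        ≡⟨ xorSum-cycle (λ e′ → crossing e e′ xor crossing e′ e) ⟩
      xorSum (range 0 L) (λ j → crossing e (E j) xor crossing (E j) e)
        ≡⟨ xorSum-cong-∈ (range 0 L) (λ j∈ → around (proj₂ (∈-range⁻ 0 L j∈))) ⟩
      xorSum (range 0 L) (λ j → φ (u j) xor φ (u (suc j)))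
        ≡⟨ xorSum-xor (range 0 L) (φ ∘ u) (λ j → φ (u (suc j))) ⟩
      xorSum (range 0 L) (φ ∘ u) xor xorSum (range 0 L) (λ j → φ (u (suc j)))
        ≡⟨ cong (xorSum (range 0 L) (φ ∘ u) xor_)
            (xorSum-range-rotate (φ ∘ u) (suc (double q)) (cong (φ ∘ toℕ) V-periodic)) ⟩
      xorSum (range 0 L) (φ ∘ u) xor xorSum (range 0 L) (φ ∘ u)
        ≡⟨ xor-same (xorSum (range 0 L) (φ ∘ u)) ⟩
      false ∎
      where
      open ≡-Reasoning
      φ : ℕ → Bool
      φ x = (x >ᵇ toℕ (tail e)) xor (x >ᵇ toℕ (head e))
      around : ∀ {j} → j < L → crossing e (E j) xor crossing (E j) e ≡ φ (u j) xor φ (u (suc j))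
      around {j} j<L = begin
        crossing e (E j) xor crossing (E j) e
          ≡⟨ crossing-pair (λ { refl → case (trans (sym e∉C) (E-∈ j<L)) }) (apart (E-∈ j<L)) ⟩
        risingEdges e (E j)
          ≡⟨ risingEdges-joins (inj₁ (refl , refl)) (E-joins j<L) ⟩
        risingBetween (toℕ (tail e)) (toℕ (head e)) (u j) (u (suc j))
          ≡⟨ risingBetween-split (toℕ (tail e)) (toℕ (head e)) (u j) (u (suc j)) ⟩
        φ (u j) xor φ (u (suc j)) ∎
        where
        case : false ≢ true
        case ()

    Descents : Bool
    Descents = xorSum (range 0 L) (λ j → u j >ᵇ u (suc j))

    reversals-cycle : reversals (member C) ≡ Descents xor agreement
    reversals-cycle = begin
      reversals (member C)
        ≡⟨ xorSum-cycle reversed ⟩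
      xorSum (range 0 L) (reversed ∘ E)
        ≡⟨ xorSum-cong-∈ (range 0 L) (λ j∈ → reversed-along (proj₂ (∈-range⁻ 0 L j∈))) ⟩
      xorSum (range 0 L) (λ j → (true xor (u j >ᵇ u (suc j))) xor agrees j)
        ≡⟨ xorSum-xor (range 0 L) (λ j → true xor (u j >ᵇ u (suc j))) agrees ⟩
      xorSum (range 0 L) (λ j → true xor (u j >ᵇ u (suc j))) xor agreement
        ≡⟨ cong (_xor agreement) (xorSum-xor (range 0 L) (λ _ → true) (λ j → u j >ᵇ u (suc j))) ⟩
      (xorSum (range 0 L) (λ _ → true) xor Descents) xor agreement
        ≡⟨ cong (λ b → (b xor Descents) xor agreement)
                (trans (xorSum-true (range 0 L))
                    (trans (cong parity (length-range 0 L)) (parity-double (suc q)))) ⟩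
      Descents xor agreement ∎
      where
      open ≡-Reasoning
      agrees : ℕ → Bool
      agrees j = ⌊ tail (E j) ≟ V j ⌋
      double-not : ∀ b → (true xor b) xor true ≡ b
      double-not = by-truth-table 1
      reversed-along : ∀ {j} → j < L → reversed (E j) ≡ (true xor (u j >ᵇ u (suc j))) xor agrees j
      reversed-along {j} j<L with E-joins j<L
      ... | inj₁ (tail≡ , head≡) rewrite tail≡ | head≡ | isYes≗does (V j ≟ V j) | dec-true (V j ≟ V j) refl =
        sym (double-not (u j >ᵇ u (suc j)))
      ... | inj₂ (tail≡ , head≡) rewrite tail≡ | head≡ | isYes≗does (V (suc j) ≟ V j) | dec-false
          (V (suc j) ≟ V j) (λ eq → adjacent-distinct j<L (cong toℕ (sym eq))) =
        trans (xor≡true⇒≡not (u j >ᵇ u (suc j)) (>ᵇ-xor-flip (adjacent-distinct j<L))) (sym (xor-identityʳ _))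

    private
      R M₁ M₂ : Fin m → Bool
      R  e = member M e ∧ not (member C e)
      M₁ e = member M e ∧ member C e
      M₂ e = not (member M e) ∧ member C e

    crossings-M₁ : crossings M₁ ≡ pairSum (everyOther 0 (suc q)) (risingAt u)
    crossings-M₁ = begin
      crossings M₁
        ≡⟨ crossings-on-cycle (member M) (not ∘ parity) M-pattern
             (λ e∈M _ e′∈M _ → oneFactor-noCommonEnd oneM e∈M e′∈M) ⟩
      pairSum (filter (T? ∘ (not ∘ parity)) (range 0 L)) (risingAt u)
        ≡⟨ cong (λ js → pairSum js (risingAt u))
             (filter-range-even (not ∘ parity) (λ j → cong not (not-involutive (parity j))) 0 (suc q) refl refl) ⟩
      pairSum (everyOther 0 (suc q)) (risingAt u) ∎
      where open ≡-Reasoning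

    crossings-M₂ : crossings M₂ ≡ pairSum (everyOther 1 (suc q)) (risingAt u)
    crossings-M₂ = begin
      crossings M₂
        ≡⟨ crossings-on-cycle (not ∘ member M) parity (λ j<L → trans (cong not (M-pattern j<L)) (not-involutive _))
             (λ e∉M e∈C e′∉M e′∈C → oneFactor-noCommonEnd oneM⊕C (∈M⊕C e∉M e∈C) (∈M⊕C e′∉M e′∈C)) ⟩
      pairSum (filter (T? ∘ parity) (range 0 L)) (risingAt u)
        ≡⟨ cong (λ js → pairSum js (risingAt u))
            (filter-range-odd parity (λ j → not-involutive (parity j)) 0 (suc q) refl refl) ⟩
      pairSum (everyOther 1 (suc q)) (risingAt u) ∎
      where
      open ≡-Reasoning
      ∈M⊕C : ∀ {e} → not (member M e) ≡ true → member C e ≡ true → member (_⊕_ G M C) e ≡ true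
      ∈M⊕C {e} e∉M e∈C = trans (member-⊕ M C e) (cong₂ _xor_ (trans (sym (not-involutive _)) (cong not e∉M)) e∈C)

    crossingsBetween-vanish :
      (crossingsBetween R M₁ xor crossingsBetween M₁ R) xor
          (crossingsBetween R M₂ xor crossingsBetween M₂ R) ≡ false
    crossingsBetween-vanish = begin
      (crossingsBetween R M₁ xor crossingsBetween M₁ R) xor (crossingsBetween R M₂ xor crossingsBetween M₂ R)
        ≡⟨ cong₂ _xor_ (crossingsBetween-sym R M₁) (crossingsBetween-sym R M₂) ⟩
      xorSum edges (λ e → R e ∧ Around M₁ e) xor xorSum edges (λ e → R e ∧ Around M₂ e)
        ≡⟨ sym (xorSum-xor edges _ _) ⟩
      xorSum edges (λ e → (R e ∧ Around M₁ e) xor (R e ∧ Around M₂ e))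
        ≡⟨ xorSum-cong edges (λ e → trans (sym (∧-distribˡ-xor (R e) _ _))
             (cong (R e ∧_) (trans (sym (xorSum-xor edges _ _))
                 (xorSum-cong edges (λ e′ → merge (member M e′) (member C e′) _))))) ⟩
      xorSum edges (λ e → R e ∧ Around (member C) e)
        ≡⟨ xorSum-cong edges (λ e → vanish (member M e) (member C e) refl refl) ⟩
      xorSum edges (λ _ → false)
        ≡⟨ xorSum-false edges ⟩
      false ∎
      where
      open ≡-Reasoning
      Around : (Fin m → Bool) → Fin m → Bool
      Around X e = xorSum edges (λ e′ → X e′ ∧ (crossing e e′ xor crossing e′ e))
      merge : ∀ a c k → ((a ∧ c) ∧ k) xor ((not a ∧ c) ∧ k) ≡ c ∧ k
      merge false c k = refl
      merge true  c k = xor-identityʳ _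
      vanish : ∀ {e} a c → member M e ≡ a → member C e ≡ c → (a ∧ not c) ∧ Around (member C) e ≡ false
      vanish false c     _    _    = refl
      vanish true  true  _    _    = refl
      vanish true  false e∈M e∉C = crossings-with-cycle-vanish e∉C (off-cycle-M-edge-apart e∈M e∉C)

    sign-swap : sign M xor sign (_⊕_ G M C) ≡ not agreement
    sign-swap = begin
      (crossings (member M) xor reversals (member M)) xor (crossings (member M⊕C) xor reversals (member M⊕C))
        ≡⟨ cong₂ _xor_ (cong₂ _xor_ (crossings-cong M≗) (reversals-cong M≗))
            (cong₂ _xor_ (crossings-cong M⊕C≗) (reversals-cong M⊕C≗)) ⟩
      (crossings (λ e → R e xor M₁ e) xor reversals (λ e → R e xor M₁ e))
        xor (crossings (λ e → R e xor M₂ e) xor reversals (λ e → R e xor M₂ e))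
        ≡⟨ cong₂ _xor_ (cong₂ _xor_ (crossings-xor R M₁) (reversals-xor R M₁))
            (cong₂ _xor_ (crossings-xor R M₂) (reversals-xor R M₂)) ⟩
      (((crossings R xor crossings M₁) xor (crossingsBetween R M₁ xor crossingsBetween M₁ R)) xor
          (reversals R xor reversals M₁))
        xor (((crossings R xor crossings M₂) xor (crossingsBetween R M₂ xor crossingsBetween M₂ R)) xor
            (reversals R xor reversals M₂))
        ≡⟨ regroup (crossings R) (crossings M₁) (crossings M₂) (crossingsBetween R M₁) (crossingsBetween M₁ R)
                   (crossingsBetween R M₂) (crossingsBetween M₂ R) (reversals R) (reversals M₁) (reversals M₂) ⟩
      (crossings M₁ xor crossings M₂)
        xor (((crossingsBetween R M₁ xor crossingsBetween M₁ R) xor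
            (crossingsBetween R M₂ xor crossingsBetween M₂ R))
             xor (reversals M₁ xor reversals M₂))
        ≡⟨ cong₂ _xor_ (cong₂ _xor_ crossings-M₁ crossings-M₂)
            (cong₂ _xor_ crossingsBetween-vanish reversals-M₁⊕M₂) ⟩
      Rising xor (false xor (Descents xor agreement))
        ≡⟨ sym (xor-assoc Rising Descents agreement) ⟩
      (Rising xor Descents) xor agreement
        ≡⟨ cong (_xor agreement) matchings-rising-parity ⟩
      not agreement ∎
      where
      open ≡-Reasoning
      M⊕C : EdgeSet G
      M⊕C = _⊕_ G M C
      Rising : Bool
      Rising = pairSum (everyOther 0 (suc q)) (risingAt u) xor pairSum (everyOther 1 (suc q)) (risingAt u)
      M≗ : ∀ e → member M e ≡ R e xor M₁ e
      M≗ e = split (member M e) (member C e)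
        where
        split : ∀ a c → a ≡ (a ∧ not c) xor (a ∧ c)
        split false c     = refl
        split true  false = refl
        split true  true  = refl
      M⊕C≗ : ∀ e → member M⊕C e ≡ R e xor M₂ e
      M⊕C≗ e = trans (member-⊕ M C e) (split (member M e) (member C e))
        where
        split : ∀ a c → a xor c ≡ (a ∧ not c) xor (not a ∧ c)
        split false c     = refl
        split true  false = refl
        split true  true  = refl
      reversals-M₁⊕M₂ : reversals M₁ xor reversals M₂ ≡ Descents xor agreement
      reversals-M₁⊕M₂ = trans (sym (reversals-xor M₁ M₂))
        (trans (reversals-cong (λ e → merge (member M e) (member C e))) reversals-cycle)
        where
        merge : ∀ a c → (a ∧ c) xor (not a ∧ c) ≡ c
        merge false c = refl
        merge true  c = xor-identityʳ c
      regroup : ∀ r q₁ q₂ b₁ b₁′ b₂ b₂′ d d₁ d₂ →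
                (((r xor q₁) xor (b₁ xor b₁′)) xor (d xor d₁)) xor (((r xor q₂) xor (b₂ xor b₂′)) xor (d xor d₂))
                ≡ (q₁ xor q₂) xor (((b₁ xor b₁′) xor (b₂ xor b₂′)) xor (d₁ xor d₂))
      regroup = by-truth-table 10

module AlternatingCircuits (G : Digraph) where
  open Digraph G
  open EdgeSets G
  open Sign G
  open Cycles G
  open SwapAlongCycle G

  module _ {M F C : EdgeSet G} (oneM : IsOneFactor G M) (oneF : IsOneFactor G F)
           (C⊆M⊕F : ∀ e → member C e ≡ true → member M e xor member F e ≡ true) where

    private
      M⊕C : EdgeSet G
      M⊕C = _⊕_ G M C

    swap-even-cycle : ∀ {q} (cy : Cycle C (double (suc q))) →
                      IsOneFactor G M⊕C × (sign M xor sign M⊕C ≡ not (Cycle.agreement cy))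
    swap-even-cycle {q} cy = oneM⊕C , sign-by-first-edge (member M (E 0)) refl
      where
      open Cycle cy
      open CycleFacts cy using (module Swap; module Alternating)
      open Alternating oneM oneF C⊆M⊕F using (alternates; F₁-pattern)
      oneM⊕C : IsOneFactor G M⊕C
      oneM⊕C = Swap.swap-oneFactor oneM alternates
      -- sign-swap needs the first edge of the cycle in the 1-factor; otherwise swap the roles of M and M ⊕ C.
      sign-by-first-edge : ∀ b → member M (E 0) ≡ b → sign M xor sign M⊕C ≡ not agreement
      sign-by-first-edge true E₀∈M =
        sign-swap oneM oneM⊕C cy (λ {j} j<L → trans (F₁-pattern (<⇒≤ j<L)) (cong (_xor parity j) E₀∈M))
      sign-by-first-edge false E₀∉M =
        trans (xor-comm (sign M) (sign M⊕C))
              (subst (λ X → sign M⊕C xor sign X ≡ not agreement) (⊕-cancelʳ M C)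
                     (sign-swap oneM⊕C (subst (IsOneFactor G) (sym (⊕-cancelʳ M C)) oneM) cy M⊕C-pattern))
        where
        M⊕C-pattern : ∀ {j} → j < double (suc q) → member M⊕C (E j) ≡ not (parity j)
        M⊕C-pattern {j} j<L = trans (member-⊕ M C (E j))
          (trans (cong₂ _xor_ (trans (F₁-pattern (<⇒≤ j<L)) (cong (_xor parity j) E₀∉M)) (E-∈ j<L))
              (xor-comm (parity j) true))

    swap-cycle : ∀ {l} (cy : Cycle C (suc (suc l))) →
                 parity (suc (suc l)) ≡ false × IsOneFactor G M⊕C ×
                     (sign M xor sign M⊕C ≡ not (Cycle.agreement cy))
    swap-cycle {l} cy with parity≡false⇒double _ (CycleFacts.Alternating.even-length cy oneM oneF C⊆M⊕F)
    ... | suc q , L≡ = by-length (suc-injective (suc-injective L≡)) cy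
      where
      by-length : l ≡ double q → (cy′ : Cycle C (suc (suc l))) →
                  parity (suc (suc l)) ≡ false × IsOneFactor G M⊕C ×
                      (sign M xor sign M⊕C ≡ not (Cycle.agreement cy′))
      by-length refl cy′ = parity-double (suc q) , swap-even-cycle cy′

    module _ (t : Traversal G) (t-traverses : Traverses G t C) where
      open FromTraversal t t-traverses using (cycle; parity-agreements)

      traversal-even : parity (length′ t) ≡ false
      traversal-even = proj₁ (swap-cycle cycle)

      -- The left-hand side does not mention t: all traversals of C have the same clockwise parity.
      sign-swap-traversal : sign M xor sign M⊕C ≡ not (parity (agreements t))
      sign-swap-traversal = trans (proj₂ (proj₂ (swap-cycle cycle))) (cong not (sym parity-agreements))

    swap-oneFactor : IsCircuit G C → IsOneFactor G M⊕C
    swap-oneFactor (t , t-traverses) = proj₁ (proj₂ (swap-cycle (FromTraversal.cycle t t-traverses)))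

    ClockwiseEven⇒sign-swap : ClockwiseEven G C → sign M xor sign M⊕C ≡ true
    ClockwiseEven⇒sign-swap (t , t-traverses , _ , even) =
      trans (sign-swap-traversal t t-traverses) (cong not (Equivalence.to (Even⇔parity≡false (agreements t)) even))

    ClockwiseOdd⇒sign-swap : ClockwiseOdd G C → sign M xor sign M⊕C ≡ false
    ClockwiseOdd⇒sign-swap (t , t-traverses , _ , odd) =
      trans (sign-swap-traversal t t-traverses) (cong not (Equivalence.to (Odd⇔parity≡true (agreements t)) odd))

    sign-swap⇒ClockwiseEven : IsCircuit G C → sign M xor sign M⊕C ≡ true → ClockwiseEven G C
    sign-swap⇒ClockwiseEven (t , t-traverses) swap≡true =
      t , t-traverses , Equivalence.from (Even⇔parity≡false (length′ t)) (traversal-even t t-traverses) ,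
      Equivalence.from (Even⇔parity≡false (agreements t))
        (trans (sym (not-involutive _)) (cong not (trans (sym (sign-swap-traversal t t-traverses)) swap≡true)))

    sign-swap⇒ClockwiseOdd : IsCircuit G C → sign M xor sign M⊕C ≡ false → ClockwiseOdd G C
    sign-swap⇒ClockwiseOdd (t , t-traverses) swap≡false =
      t , t-traverses , Equivalence.from (Even⇔parity≡false (length′ t)) (traversal-even t t-traverses) ,
      Equivalence.from (Odd⇔parity≡true (agreements t))
        (trans (sym (not-involutive _)) (cong not (trans (sym (sign-swap-traversal t t-traverses)) swap≡false)))

-- Circuits in the symmetric difference of two 1-factors
module Components (G : Digraph) where
  open Digraph G
  open EdgeSets G
  open Cycles G

  module _ {M M′ : EdgeSet G} (oneM : IsOneFactor G M) (oneM′ : IsOneFactor G M′) where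

    InSymDiff : Fin m → Set
    InSymDiff e = member M e xor member M′ e ≡ true

    symDiff-edges-at : ∀ {x a b} → InSymDiff a → InSymDiff b → Incident G a x → Incident G b x →
                       member M b ≡ not (member M a) → ∀ {e} → InSymDiff e → Incident G e x → (e ≡ a) ⊎ (e ≡ b)
    symDiff-edges-at {x} {a} {b} a∈S b∈S a∋x b∋x b∈M? {e} e∈S e∋x
      with member M a in a∈M? | member M e in e∈M?
    ... | true  | true  = inj₁ (oneFactor-unique oneM (member⇒∈ e∈M?) (member⇒∈ a∈M?) e∋x a∋x)
    ... | false | true  = inj₂ (oneFactor-unique oneM (member⇒∈ e∈M?) (member⇒∈ b∈M?) e∋x b∋x)
    ... | false | false = inj₁ (oneFactor-unique oneM′ (member⇒∈ e∈S) (member⇒∈ a∈S) e∋x a∋x)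
    ... | true  | false =
      inj₂ (oneFactor-unique oneM′ (member⇒∈ e∈S) (member⇒∈ (trans (cong (_xor _) (sym b∈M?)) b∈S)) e∋x b∋x)

    private
      module Closed {D : EdgeSet G} {l : ℕ} (cy : Cycle D (suc (suc l)))
          (D⊆S : ∀ e → member D e ≡ true → InSymDiff e) where
        open Cycle cy
        open CycleFacts cy
        open Alternating oneM oneM′ D⊆S using (alternates)
        open Swap oneM alternates using (M-prev)

        closed-at : ∀ {i} → i < L → ∀ {e} → InSymDiff e → Incident G e (V i) → member D e ≡ true
        closed-at i<L e∈S e∋Vi
          with symDiff-edges-at (D⊆S _ (E-∈ i<L)) (D⊆S _ (E-∈ (prev-< i<L))) (E-incident i<L)
              (E-prev-incident i<L) (M-prev i<L) e∈S e∋Vi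
        ... | inj₁ refl = E-∈ i<L
        ... | inj₂ refl = E-∈ (prev-< i<L)

        closed : ∀ {e e′ x} → member D e ≡ true → Incident G e x → InSymDiff e′ → Incident G e′ x → member
            D e′ ≡ true
        closed e∈D e∋x e′∈S e′∋x with endpoint-on-cycle e∈D e∋x
        ... | i , i<L , refl = closed-at i<L e′∈S e′∋x

      module Spread {C D : EdgeSet G} {lc ld : ℕ} (cC : Cycle C (suc (suc lc))) (cD : Cycle D (suc (suc ld)))
                    (C⊆S : ∀ e → member C e ≡ true → InSymDiff e)
                        (D⊆S : ∀ e → member D e ≡ true → InSymDiff e) where
        open Cycle cC
        open CycleFacts cC using (L; next-edge)

        InD : ℕ → Set
        InD j = member D (E j) ≡ true

        step : ∀ {j} → j < L → InD j → InD (suc j)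
        step j<L Ej∈D = let Esj∋ , Esj∈C , _ = next-edge j<L in
          Closed.closed cD D⊆S Ej∈D (joins⇒incidentʳ (E-joins j<L)) (C⊆S _ Esj∈C) Esj∋

        reach : ∀ {i} j → i ≤ j → j ≤ L → InD i → InD j
        reach zero    z≤n   _    InDi = InDi
        reach (suc j) i≤sj sj≤L InDi with m≤n⇒m<n∨m≡n i≤sj
        ... | inj₂ refl = InDi
        ... | inj₁ i<sj = step sj≤L (reach j (≤-pred i<sj) (<⇒≤ sj≤L) InDi)

        all-in : ∀ {j₀} → j₀ < L → InD j₀ → ∀ e → member C e ≡ true → member D e ≡ true
        all-in j₀<L InDj₀ e e∈C with E-onto e e∈C
        ... | j , j<L , refl = reach j z≤n (<⇒≤ j<L)
            (subst (λ e → member D e ≡ true) E-periodic (reach L (<⇒≤ j₀<L) ≤-refl InDj₀))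

    circuits-sharing-edge-≡ : ∀ {C D} → IsCircuit G C → IsCircuit G D →
      (∀ e → member C e ≡ true → InSymDiff e) → (∀ e → member D e ≡ true → InSymDiff e) →
      ∀ {e} → member C e ≡ true → member D e ≡ true → C ≡ D
    circuits-sharing-edge-≡ {C} {D} (t , t-traverses) (s , s-traverses) C⊆S D⊆S {e} e∈C e∈D =
      member-ext (λ e′ → bool-ext (⊆ cC cD C⊆S D⊆S e∈C e∈D e′) (⊆ cD cC D⊆S C⊆S e∈D e∈C e′))
      where
      cC : Cycle C (suc (suc (len t)))
      cC = FromTraversal.cycle t t-traverses
      cD : Cycle D (suc (suc (len s)))
      cD = FromTraversal.cycle s s-traverses
      ⊆ : ∀ {X Y lx ly} (cX : Cycle X (suc (suc lx))) (cY : Cycle Y (suc (suc ly))) →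
          (∀ e → member X e ≡ true → InSymDiff e) → (∀ e → member Y e ≡ true → InSymDiff e) →
          member X e ≡ true → member Y e ≡ true → ∀ e′ → member X e′ ≡ true → member Y e′ ≡ true
      ⊆ cX cY X⊆S Y⊆S e∈X e∈Y with Cycle.E-onto cX e e∈X
      ... | j₀ , j₀<L , refl = Spread.all-in cX cY X⊆S Y⊆S j₀<L e∈Y

module Partners (G : Digraph) where
  open Digraph G
  open EdgeSets G

  other-end : Fin m → Fin n → Fin n
  other-end e x = if ⌊ tail e ≟ x ⌋ then head e else tail e

  other-end-joins : ∀ {e x} → Incident G e x → Joins G e x (other-end e x)
  other-end-joins {e} {x} e∋x with tail e ≟ x | e∋x
  ... | yes tail≡x | _          = inj₁ (tail≡x , refl)
  ... | no tail≢x  | inj₁ tail≡x = ⊥-elim (tail≢x tail≡x)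
  ... | no _       | inj₂ head≡x = inj₂ (refl , head≡x)

  other-end-of-joins : ∀ {e a b} → Joins G e a b → other-end e b ≡ a
  other-end-of-joins {e} {b = b} (inj₁ (tail≡a , head≡b)) with tail e ≟ b
  ... | yes tail≡b = trans head≡b (trans (sym tail≡b) tail≡a)
  ... | no _       = tail≡a
  other-end-of-joins {e} {b = b} (inj₂ (tail≡b , head≡a)) with tail e ≟ b
  ... | yes _      = head≡a
  ... | no tail≢b  = ⊥-elim (tail≢b tail≡b)

  module Partner {F : EdgeSet G} (oneF : IsOneFactor G F) where
    edge-at : Fin n → Fin m
    edge-at x = proj₁ (oneF x)

    edge-at-∈ : ∀ x → member F (edge-at x) ≡ true
    edge-at-∈ x = ∈⇒member (proj₁ (proj₂ (oneF x)))

    edge-at-incident : ∀ x → Incident G (edge-at x) x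
    edge-at-incident x = proj₁ (proj₂ (proj₂ (oneF x)))

    edge-at-unique : ∀ {x e} → member F e ≡ true → Incident G e x → e ≡ edge-at x
    edge-at-unique {x} {e} e∈F e∋x = proj₂ (proj₂ (proj₂ (oneF x))) e (member⇒∈ e∈F) e∋x

    partner : Fin n → Fin n
    partner x = other-end (edge-at x) x

    partner-joins : ∀ x → Joins G (edge-at x) x (partner x)
    partner-joins x = other-end-joins (edge-at-incident x)

    edge-at-partner : ∀ x → edge-at (partner x) ≡ edge-at x
    edge-at-partner x = sym (edge-at-unique (edge-at-∈ x) (joins⇒incidentʳ (partner-joins x)))

    partner-involutive : ∀ x → partner (partner x) ≡ x
    partner-involutive x = trans (cong (λ e → other-end e (partner x)) (edge-at-partner x))
        (other-end-of-joins (partner-joins x))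

    partner-injective : ∀ {x y} → partner x ≡ partner y → x ≡ y
    partner-injective {x} {y} eq = trans (sym (partner-involutive x))
        (trans (cong partner eq) (partner-involutive y))

module Least (P : ℕ → Set) (P? : ∀ k → Dec (P k)) where
  least-below : ∀ n → (Σ ℕ λ p → p < n × P p × (∀ {i} → i < p → ¬ P i)) ⊎ (∀ {i} → i < n → ¬ P i)
  least-below zero    = inj₂ λ ()
  least-below (suc n) with least-below n
  ... | inj₁ (p , p<n , Pp , below-p) = inj₁ (p , m≤n⇒m≤1+n p<n , Pp , below-p)
  ... | inj₂ none with P? n
  ...   | yes Pn = inj₁ (n , ≤-refl , Pn , none)
  ...   | no ¬Pn = inj₂ λ i<sn → below-n (m≤n⇒m<n∨m≡n (≤-pred i<sn))
    where
    below-n : ∀ {i} → (i < n) ⊎ (i ≡ n) → ¬ P i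
    below-n (inj₁ i<n)  = none i<n
    below-n (inj₂ refl) = ¬Pn

  least : ∀ {k} → P k → Σ ℕ λ p → P p × (∀ {i} → i < p → ¬ P i)
  least {k} Pk with least-below (suc k)
  ... | inj₁ (p , _ , Pp , below-p) = p , Pp , below-p
  ... | inj₂ none = ⊥-elim (none ≤-refl Pk)

module SymmetricDifferenceCircuits (G : Digraph) where
  open Digraph G
  open EdgeSets G
  open Partners G

  edgeSetOf : ∀ {L} → (Fin L → Fin m) → EdgeSet G
  edgeSetOf ed = tabulate (λ e → ⌊ any? (λ i → ed i ≟ e) ⌋)

  traverses-edgeSetOf : ∀ (t : Traversal G) → Traverses G t (edgeSetOf (edge t))
  traverses-edgeSetOf t e = mk⇔
    (λ e∈ → to (any? (λ i → edge t i ≟ e)) (trans (sym (lookup∘tabulate _ e)) (∈⇒member e∈)))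
    (λ found → member⇒∈ (trans (lookup∘tabulate _ e) (from (any? (λ i → edge t i ≟ e)) found)))
    where
    to : (d : Dec (Σ _ λ i → edge t i ≡ e)) → ⌊ d ⌋ ≡ true → Σ _ λ i → edge t i ≡ e
    to (yes found) _ = found
    from : (d : Dec (Σ _ λ i → edge t i ≡ e)) → (Σ _ λ i → edge t i ≡ e) → ⌊ d ⌋ ≡ true
    from (yes _)     _     = refl
    from (no none)   found = ⊥-elim (none found)

  module _ {M M′ : EdgeSet G} (oneM : IsOneFactor G M) (oneM′ : IsOneFactor G M′)
           (loopless : ∀ e → member M e xor member M′ e ≡ true → tail e ≢ head e)
           {e₀ : Fin m} (e₀∈S : member M e₀ xor member M′ e₀ ≡ true) where

    open Components G using (InSymDiff)
    private
      module PM  = Partner oneM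
      module PM′ = Partner oneM′
      S : Fin m → Set
      S = InSymDiff oneM oneM′

    -- x is met by an edge of M ⊕ M′.
    Active : Fin n → Set
    Active x = PM.edge-at x ≢ PM′.edge-at x

    active : ∀ {e x} → S e → Incident G e x → Active x
    active {e} {x} e∈S e∋x eq with member M e in e∈M?
    ... | true  with () ← trans (sym
        (cong (true xor_) (trans (cong (member M′) (trans (PM.edge-at-unique e∈M? e∋x) eq))
            (PM′.edge-at-∈ x)))) e∈S
    ... | false with () ← trans (sym e∈M?)
        (trans (cong (member M) (trans (PM′.edge-at-unique e∈S e∋x) (sym eq))) (PM.edge-at-∈ x))

    M-edge-∈S : ∀ {x} → Active x → S (PM.edge-at x)
    M-edge-∈S {x} act with member M′ (PM.edge-at x) in e∈M′?
    ... | true  = ⊥-elim (act (PM′.edge-at-unique e∈M′? (PM.edge-at-incident x)))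
    ... | false = cong (_xor false) (PM.edge-at-∈ x)

    M′-edge-∈S : ∀ {x} → Active x → S (PM′.edge-at x)
    M′-edge-∈S {x} act with member M (PM′.edge-at x) in e∈M?
    ... | true  = ⊥-elim (act (sym (PM.edge-at-unique e∈M? (PM′.edge-at-incident x))))
    ... | false = PM′.edge-at-∈ x

    M-partner-moves : ∀ {x} → Active x → PM.partner x ≢ x
    M-partner-moves {x} act eq =
      loopless _ (M-edge-∈S act) (joins-same⇒loop (subst (Joins G (PM.edge-at x) x) eq (PM.partner-joins x)))

    M′-partner-moves : ∀ {x} → Active x → PM′.partner x ≢ x
    M′-partner-moves {x} act eq =
      loopless _ (M′-edge-∈S act) (joins-same⇒loop (subst (Joins G (PM′.edge-at x) x) eq (PM′.partner-joins x)))

    walk : ℕ → Fin n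
    walk zero    = tail e₀
    walk (suc k) = if parity k then PM′.partner (walk k) else PM.partner (walk k)

    walk-edge : ℕ → Fin m
    walk-edge k = if parity k then PM′.edge-at (walk k) else PM.edge-at (walk k)

    walk-joins : ∀ k → Joins G (walk-edge k) (walk k) (walk (suc k))
    walk-joins k with parity k
    ... | true  = PM′.partner-joins (walk k)
    ... | false = PM.partner-joins (walk k)

    walk-active : ∀ k → Active (walk k)
    walk-edge-∈S : ∀ k → S (walk-edge k)
    walk-active zero    = active e₀∈S (inj₁ refl)
    walk-active (suc k) = active (walk-edge-∈S k) (joins⇒incidentʳ (walk-joins k))
    walk-edge-∈S k with parity k
    ... | true  = M′-edge-∈S (walk-active k)
    ... | false = M-edge-∈S (walk-active k)

    walk-edge-∈M : ∀ k → member M (walk-edge k) ≡ not (parity k)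
    walk-edge-∈M k with parity k | walk-edge-∈S k
    ... | true  | ∈S = xor≡true∧true⇒false ∈S (PM′.edge-at-∈ (walk k))
    ... | false | _  = PM.edge-at-∈ (walk k)

    orbit : ℕ → Fin n
    orbit k = walk (double k)

    walk-odd : ∀ k → walk (suc (double k)) ≡ PM.partner (orbit k)
    walk-odd k = cong (λ b → if b then PM′.partner (orbit k) else PM.partner (orbit k)) (parity-double k)

    orbit-suc : ∀ k → orbit (suc k) ≡ PM′.partner (PM.partner (orbit k))
    orbit-suc k = trans (cong (λ b → if b then PM′.partner (walk (suc (double k))) else PM.partner
        (walk (suc (double k))))
                              (cong not (parity-double k)))
                        (cong PM′.partner (walk-odd k))

    orbit-shift : ∀ a d → orbit a ≡ orbit (a + d) → orbit 0 ≡ orbit d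
    orbit-shift zero    d eq = eq
    orbit-shift (suc a) d eq = orbit-shift a d
      (PM.partner-injective (PM′.partner-injective (trans (sym (orbit-suc a)) (trans eq (orbit-suc (a + d))))))

    -- No orbit point is the M-partner of another: otherwise some partner map would have a fixed point,
    -- i.e. M ⊕ M′ would contain a loop.
    Opposite : ℕ → ℕ → Set
    Opposite a b = orbit a ≡ PM.partner (orbit b)

    opposite-sym : ∀ {a b} → Opposite a b → Opposite b a
    opposite-sym {a} {b} opp = sym (trans (cong PM.partner opp) (PM.partner-involutive (orbit b)))

    opposite-step : ∀ {a b} → Opposite a (suc b) → Opposite (suc a) b
    opposite-step {a} {b} opp = begin
      orbit (suc a)                                   ≡⟨ orbit-suc a ⟩
      PM′.partner (PM.partner (orbit a))              ≡⟨ cong (PM′.partner ∘′ PM.partner) opp ⟩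
      PM′.partner (PM.partner (PM.partner (orbit (suc b)))) ≡⟨ cong PM′.partner
          (PM.partner-involutive (orbit (suc b))) ⟩
      PM′.partner (orbit (suc b))                     ≡⟨ cong PM′.partner (orbit-suc b) ⟩
      PM′.partner (PM′.partner (PM.partner (orbit b))) ≡⟨ PM′.partner-involutive (PM.partner (orbit b)) ⟩
      PM.partner (orbit b)                            ∎
      where open ≡-Reasoning

    no-opposite-gap : ∀ d a → ¬ Opposite a (d + a)
    no-opposite-gap zero          a opp = M-partner-moves (walk-active (double a)) (sym opp)
    no-opposite-gap (suc zero)    a opp =
      M′-partner-moves (subst Active (walk-odd a) (walk-active (suc (double a))))
          (trans (sym (orbit-suc a)) (opposite-step {a} {a} opp))
    no-opposite-gap (suc (suc d)) a opp =
      no-opposite-gap d (suc a) (subst (Opposite (suc a)) (sym (+-suc d a)) (opposite-step {a} {suc (d + a)} opp))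

    no-opposite : ∀ a b → ¬ Opposite a b
    no-opposite a b opp with ≤-total a b
    ... | inj₁ a≤b = no-opposite-gap (b ∸ a) a (subst (Opposite a) (sym (m∸n+n≡m a≤b)) opp)
    ... | inj₂ b≤a = no-opposite-gap (a ∸ b) b (subst (Opposite b) (sym (m∸n+n≡m b≤a)) (opposite-sym {a} {b} opp))

    orbit-returns : Σ ℕ λ r → orbit (suc r) ≡ orbit 0
    orbit-returns with pigeonhole (n<1+n n) (λ (i : Fin (suc n)) → orbit (toℕ i))
    ... | i , j , i<j , eq with m≤n⇒∃[o]m+o≡n i<j
    ...   | o , i+o≡j = o , sym (orbit-shift (toℕ i) (suc o)
        (trans eq (cong orbit (trans (sym i+o≡j) (sym (+-suc (toℕ i) o))))))

    -- opaque, so that the period is never unfolded into the pigeonhole computation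
    opaque
      minimal-return : Σ ℕ λ r → orbit (suc r) ≡ orbit 0 × (∀ {i} → i < r → orbit (suc i) ≢ orbit 0)
      minimal-return = Least.least (λ k → orbit (suc k) ≡ orbit 0) (λ k → orbit (suc k) ≟ orbit 0)
          {proj₁ orbit-returns} (proj₂ orbit-returns)

    r : ℕ
    r = proj₁ minimal-return

    orbit-period : orbit (suc r) ≡ orbit 0
    orbit-period = proj₁ (proj₂ minimal-return)

    orbit-injective-≤ : ∀ {a b} → a ≤ b → b < suc r → orbit a ≡ orbit b → a ≡ b
    orbit-injective-≤ {a} {b} a≤b b<p eq with m≤n⇒∃[o]m+o≡n a≤b
    ... | zero  , a+0≡b = trans (sym (+-identityʳ a)) a+0≡b
    ... | suc o , a+o≡b = ⊥-elim (proj₂ (proj₂ minimal-return) o<r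
        (sym (orbit-shift a (suc o) (trans eq (cong orbit (sym a+o≡b))))))
      where
      o<r : o < r
      o<r = ≤-trans (subst (suc o ≤_) a+o≡b (m≤n+m (suc o) a)) (≤-pred b<p)

    orbit-injective : ∀ {a b} → a < suc r → b < suc r → orbit a ≡ orbit b → a ≡ b
    orbit-injective {a} {b} a<p b<p eq with ≤-total a b
    ... | inj₁ a≤b = orbit-injective-≤ a≤b b<p eq
    ... | inj₂ b≤a = sym (orbit-injective-≤ b≤a a<p (sym eq))

    L : ℕ
    L = double (suc r)

    walk-periodic : walk L ≡ walk 0
    walk-periodic = orbit-period

    half : ∀ k → Σ ℕ λ j → (k ≡ double j × walk k ≡ orbit j) ⊎ (k ≡ suc (double j) × walk k ≡ PM.partner (orbit j))
    half zero = 0 , inj₁ (refl , refl)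
    half (suc k) with half k
    ... | j , inj₁ (refl , _) = j , inj₂ (refl , walk-odd j)
    ... | j , inj₂ (refl , _) = suc j , inj₁ (refl , refl)

    double-<-cancel : ∀ {j k} → double j < double k → j < k
    double-<-cancel {zero}  {suc k} _                  = z<s
    double-<-cancel {suc j} {suc k} (s≤s (s≤s 2j<2k)) = s≤s (double-<-cancel 2j<2k)

    walk-injective : ∀ {a b} → a < L → b < L → walk a ≡ walk b → a ≡ b
    walk-injective {a} {b} a<L b<L eq with half a | half b
    ... | j , inj₁ (refl , wa) | j′ , inj₁ (refl , wb) =
      cong double (orbit-injective (double-<-cancel a<L) (double-<-cancel b<L) (trans (sym wa) (trans eq wb)))
    ... | j , inj₂ (refl , wa) | j′ , inj₂ (refl , wb) =
      cong (suc ∘′ double) (orbit-injective (double-<-cancel (<⇒≤ a<L)) (double-<-cancel (<⇒≤ b<L))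
                                            (PM.partner-injective (trans (sym wa) (trans eq wb))))
    ... | j , inj₁ (refl , wa) | j′ , inj₂ (refl , wb) = ⊥-elim (no-opposite j j′ (trans (sym wa) (trans eq wb)))
    ... | j , inj₂ (refl , wa) | j′ , inj₁ (refl , wb) = ⊥-elim
        (no-opposite j′ j (trans (sym wb) (trans (sym eq) wa)))

    walk-edge-parity : ∀ {a b} → walk-edge a ≡ walk-edge b → parity a ≡ parity b
    walk-edge-parity {a} {b} eq = not-injective
        (trans (sym (walk-edge-∈M a)) (trans (cong (member M) eq) (walk-edge-∈M b)))

    walk-edge-injective : ∀ {a b} → a < L → b < L → walk-edge a ≡ walk-edge b → a ≡ b
    walk-edge-injective {a} {b} a<L b<L eq
      with incident-joins (walk-joins a)
          (subst (λ e → Incident G e (walk b)) (sym eq) (joins⇒incidentˡ (walk-joins b)))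
    ... | inj₁ wb≡wa = sym (walk-injective b<L a<L wb≡wa)
    ... | inj₂ wb≡wsa with m≤n⇒m<n∨m≡n a<L
    ...   | inj₁ sa<L = ⊥-elim (not-¬ (refl {x = parity a})
        (trans (walk-edge-parity {a} {b} eq) (cong parity (walk-injective {b} {suc a} b<L sa<L wb≡wsa))))
    ...   | inj₂ refl = ⊥-elim (not-¬ (refl {x = parity a}) (trans (walk-edge-parity {a} {b} eq)
                          (trans (cong parity (walk-injective {b} {0} b<L z<s (trans wb≡wsa walk-periodic)))
                              (sym (parity-double (suc r))))))

    walk-next : ∀ (i : Fin L) → walk (toℕ (next G i)) ≡ walk (suc (toℕ i))
    walk-next i with m≤n⇒m<n∨m≡n (toℕ<n i)
    ... | inj₁ si<L = cong walk (trans (toℕ-fromℕ< (m%n<n (suc (toℕ i)) L)) (m<n⇒m%n≡m si<L))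
    ... | inj₂ si≡L = trans (cong walk
        (trans (toℕ-fromℕ< (m%n<n (suc (toℕ i)) L)) (trans (cong (_% L) si≡L) (n%n≡0 L))))
                            (trans (sym walk-periodic) (cong walk (sym si≡L)))

    closed-walk : Traversal G
    closed-walk = record
      { len      = double r
      ; vert     = walk ∘′ toℕ
      ; edge     = walk-edge ∘′ toℕ
      ; vert-inj = λ i j eq → toℕ-injective (walk-injective (toℕ<n i) (toℕ<n j) eq)
      ; edge-inj = λ i j eq → toℕ-injective (walk-edge-injective (toℕ<n i) (toℕ<n j) eq)
      ; joins    = λ i → subst (Joins G (walk-edge (toℕ i)) (walk (toℕ i))) (sym (walk-next i))
          (walk-joins (toℕ i))
      }

    closed-walk-⊆S : ∀ e → member (edgeSetOf (edge closed-walk)) e ≡ true → S e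
    closed-walk-⊆S e e∈ with Equivalence.to (traverses-edgeSetOf closed-walk e) (member⇒∈ e∈)
    ... | i , refl = walk-edge-∈S (toℕ i)

  opaque
    symDiff-circuit : ∀ {M M′ : EdgeSet G} → IsOneFactor G M → IsOneFactor G M′ →
                      (∀ e → member M e xor member M′ e ≡ true → tail e ≢ head e) →
                      ∀ {e₀} → member M e₀ xor member M′ e₀ ≡ true →
                      Σ (EdgeSet G) λ C → IsCircuit G C ×
                          (∀ e → member C e ≡ true → member M e xor member M′ e ≡ true)
    symDiff-circuit oneM oneM′ loopless e₀∈S =
      edgeSetOf (edge t) , (t , traverses-edgeSetOf t) , closed-walk-⊆S oneM oneM′ loopless e₀∈S
      where
      t : Traversal G
      t = closed-walk oneM oneM′ loopless e₀∈S

-- Counting the clockwise even circuits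
module Counting (G : Digraph) where
  open Digraph G
  open EdgeSets G
  open Sign G
  open Components G
  open AlternatingCircuits G
  open SymmetricDifferenceCircuits G

  Counted : EdgeSet G → EdgeSet G → Set
  Counted S C = (C ⊆ S) × IsAlternating G C × ClockwiseEven G C

  Enumerates : List (EdgeSet G) → (EdgeSet G → Set) → Set
  Enumerates Cs P = Unique Cs × (∀ C → (C ∈ₗ Cs) ⇔ P C)

  module _ {M′ : EdgeSet G} (oneM′ : IsOneFactor G M′) where

    Loopless : EdgeSet G → Set
    Loopless M = ∀ e → member M e xor member M′ e ≡ true → tail e ≢ head e

    CountResult : EdgeSet G → Set
    CountResult M = Σ (List (EdgeSet G)) λ Cs →
      Enumerates Cs (Counted (_⊕_ G M M′)) × parity (length Cs) ≡ sign M xor sign M′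

    count-empty : ∀ {M} → Empty (_⊕_ G M M′) → CountResult M
    count-empty {M} empty =
      [] , ([] , λ C → mk⇔ (λ ()) (λ (C⊆S , (C-circuit , _) , _) → ⊥-elim (uncounted C⊆S C-circuit)))
         , trans (sym (xor-same (sign M))) (cong (λ X → sign M xor sign X) M≡M′)
      where
      S≡∅ : _⊕_ G M M′ ≡ ∅
      S≡∅ = Empty-unique empty
      M≡M′ : M ≡ M′
      M≡M′ = member-ext λ e → xor≡false⇒≡
          (trans (sym (member-⊕ M M′ e)) (trans (cong (λ X → member X e) S≡∅) (lookup-replicate e false)))
      uncounted : ∀ {C} → C ⊆ _⊕_ G M M′ → IsCircuit G C → ⊥
      uncounted C⊆S C-circuit =
        let e , e∈C = circuit-nonempty C-circuit in ∉⊥ (subst (e ∈_) S≡∅ (C⊆S (member⇒∈ e∈C)))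

    module Removing {M C₀ : EdgeSet G} (oneM : IsOneFactor G M) (C₀-circuit : IsCircuit G C₀)
                    (C₀⊆S : ∀ e → member C₀ e ≡ true → member M e xor member M′ e ≡ true) where
      private
        S S″ : EdgeSet G
        S  = _⊕_ G M M′
        S″ = _⊕_ G (_⊕_ G M C₀) M′

      member-S″ : ∀ e → member S″ e ≡ (member M e xor member M′ e) xor member C₀ e
      member-S″ e = trans (cong (λ X → member X e) (⊕-⊕-swap M M′ C₀))
          (trans (member-⊕ S C₀ e) (cong (_xor member C₀ e) (member-⊕ M M′ e)))

      S″⊆S : ∀ e → member S″ e ≡ true → member M e xor member M′ e ≡ true
      S″⊆S e e∈S″ with member C₀ e in e∈C₀?
      ... | true  = C₀⊆S e e∈C₀?
      ... | false = trans (sym (xor-identityʳ _))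
          (trans (cong ((member M e xor member M′ e) xor_) (sym e∈C₀?)) (trans (sym (member-S″ e)) e∈S″))

      C₀∉S″ : ∀ {e} → member C₀ e ≡ true → member S″ e ≡ false
      C₀∉S″ {e} e∈C₀ = trans (member-S″ e) (trans (cong₂ _xor_ (C₀⊆S e e∈C₀) e∈C₀) refl)

      outside-C₀⇒S″ : ∀ {e} → member C₀ e ≡ false → member M e xor member M′ e ≡ true → member S″ e ≡ true
      outside-C₀⇒S″ {e} e∉C₀ e∈S = trans (member-S″ e) (trans (cong₂ _xor_ e∈S e∉C₀) refl)

      S″⊂S : S″ ⊂ S
      S″⊂S = (λ {e} e∈S″ → member⇒∈ (trans (member-⊕ M M′ e) (S″⊆S e (∈⇒member e∈S″))))
           , e₀ , member⇒∈ (trans (member-⊕ M M′ e₀) (C₀⊆S e₀ e₀∈C₀))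
           , λ e₀∈S″ → false≢true (trans (sym (C₀∉S″ e₀∈C₀)) (∈⇒member e₀∈S″))
        where
        e₀ : Fin m
        e₀ = proj₁ (circuit-nonempty C₀-circuit)
        e₀∈C₀ : member C₀ e₀ ≡ true
        e₀∈C₀ = proj₂ (circuit-nonempty C₀-circuit)

      counted-grow : ∀ {C} → Counted S″ C → Counted S C
      counted-grow (C⊆S″ , alternating , clockwise-even) = proj₁ S″⊂S ∘′ C⊆S″ , alternating , clockwise-even

      C₀-uncounted : ¬ Counted S″ C₀
      C₀-uncounted (C₀⊆S″ , _) = let e₀ , e₀∈C₀ = circuit-nonempty C₀-circuit in
        false≢true (trans (sym (C₀∉S″ e₀∈C₀)) (∈⇒member (C₀⊆S″ (member⇒∈ e₀∈C₀))))

      counted-split : ∀ {C} → Counted S C → (C ≡ C₀) ⊎ Counted S″ C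
      counted-split {C} (C⊆S , alternating@(C-circuit , _) , clockwise-even)
        with circuit-nonempty C-circuit
      ... | e₁ , e₁∈C with member C₀ e₁ in e₁∈C₀?
      ...   | true  = inj₁ (share e₁∈C e₁∈C₀?)
        where
        share : ∀ {e} → member C e ≡ true → member C₀ e ≡ true → C ≡ C₀
        share = circuits-sharing-edge-≡ oneM oneM′ C-circuit C₀-circuit (⊆⊕⇒member C⊆S) C₀⊆S
      ...   | false = inj₂
        ( (λ {e} e∈C → member⇒∈ (outside-C₀⇒S″ (outside (∈⇒member e∈C)) (⊆⊕⇒member C⊆S e (∈⇒member e∈C))))
        , alternating , clockwise-even)
        where
        outside : ∀ {e} → member C e ≡ true → member C₀ e ≡ false
        outside {e} e∈C with member C₀ e in e∈C₀?
        ... | false = refl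
        ... | true  with () ← trans (sym e₁∈C₀?) (trans (sym (cong (λ X → member X e₁)
          (circuits-sharing-edge-≡ oneM oneM′ C-circuit C₀-circuit (⊆⊕⇒member C⊆S) C₀⊆S e∈C e∈C₀?))) e₁∈C)

    count-step : ∀ {M C₀} (oneM : IsOneFactor G M) (C₀-circuit : IsCircuit G C₀)
                 (C₀⊆S : ∀ e → member C₀ e ≡ true → member M e xor member M′ e ≡ true) →
                 CountResult (_⊕_ G M C₀) → CountResult M
    count-step {M} {C₀} oneM C₀-circuit C₀⊆S (Cs , (unique , members) , parity-Cs)
      with sign M xor sign (_⊕_ G M C₀) in swap-sign
    ... | true  =
      C₀ ∷ Cs , (All.tabulate (λ {C} C∈ C₀≡C → C₀-uncounted (subst (Counted _) (sym C₀≡C) (Equivalence.to (members C) C∈)))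
                 ∷ unique
                , λ C → mk⇔ (to C) (from C))
              , trans (cong not parity-Cs) (flip-parity (sign M) (sign (_⊕_ G M C₀)) (sign M′) swap-sign)
      where
      open Removing oneM C₀-circuit C₀⊆S
      to : ∀ C → C ∈ₗ C₀ ∷ Cs → Counted (_⊕_ G M M′) C
      to C (here refl) = member⇒⊆⊕ C₀⊆S , (C₀-circuit , M , M′ , oneM , oneM′ , member⇒⊆⊕ C₀⊆S)
                       , sign-swap⇒ClockwiseEven oneM oneM′ C₀⊆S C₀-circuit swap-sign
      to C (there C∈) = counted-grow (Equivalence.to (members C) C∈)
      from : ∀ C → Counted (_⊕_ G M M′) C → C ∈ₗ C₀ ∷ Cs
      from C counted with counted-split counted
      ... | inj₁ refl     = here refl
      ... | inj₂ counted″ = there (Equivalence.from (members C) counted″)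
      flip-parity : ∀ a b c → a xor b ≡ true → not (b xor c) ≡ a xor c
      flip-parity true  false c refl = refl
      flip-parity false true  c refl = not-involutive c
    ... | false = Cs , (unique , λ C → mk⇔ (counted-grow ∘′ Equivalence.to (members C)) (from C))
                , trans parity-Cs (cong (_xor sign M′) (sym (xor≡false⇒≡ {sign M} {sign (_⊕_ G M C₀)} swap-sign)))
      where
      open Removing oneM C₀-circuit C₀⊆S
      from : ∀ C → Counted (_⊕_ G M M′) C → C ∈ₗ Cs
      from C counted with counted-split counted
      ... | inj₂ counted″ = Equivalence.from (members C) counted″
      ... | inj₁ refl with () ← trans
          (sym (ClockwiseEven⇒sign-swap oneM oneM′ C₀⊆S (proj₂ (proj₂ counted)))) swap-sign

    CountAtSize : ℕ → Set
    CountAtSize k = ∀ {M} → ∣ _⊕_ G M M′ ∣ ≡ k → IsOneFactor G M → Loopless M → CountResult M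

    count : ∀ {M} → IsOneFactor G M → Loopless M → CountResult M
    count {M} = <-rec CountAtSize step _ refl
      where
      step : ∀ k → (∀ {k′} → k′ < k → CountAtSize k′) → CountAtSize k
      step k smaller {M} refl oneM loopless with nonempty? (_⊕_ G M M′)
      ... | no empty = count-empty empty
      ... | yes (e₀ , e₀∈S) with symDiff-circuit oneM oneM′ loopless
          (trans (sym (member-⊕ M M′ e₀)) (∈⇒member e₀∈S))
      ...   | C₀ , C₀-circuit , C₀⊆S = count-step oneM C₀-circuit C₀⊆S
        (smaller (p⊂q⇒∣p∣<∣q∣ S″⊂S) {_⊕_ G M C₀} refl (swap-oneFactor oneM oneM′ C₀⊆S C₀-circuit)
            (λ e e∈S″ → loopless e (S″⊆S e (trans (member-⊕ (_⊕_ G M C₀) M′ e) e∈S″))))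
        where open Removing oneM C₀-circuit C₀⊆S

module TwoCircuits (G : Digraph) {f F₁ F₂ A₁ A₂ : EdgeSet G} (one-f : IsOneFactor G f)
  (A₁-circuit : IsCircuit G A₁) (oneF₁ : IsOneFactor G F₁) (A₁⊆f⊕F₁ : A₁ ⊆ _⊕_ G f F₁)
  (A₂-circuit : IsCircuit G A₂) (oneF₂ : IsOneFactor G F₂) (A₂⊆f⊕F₂ : A₂ ⊆ _⊕_ G f F₂) where
  open Digraph G
  open EdgeSets G
  open Sign G
  open AlternatingCircuits G
  open Cycles G using (circuit-loopless)
  open Counting G

  private
    g₁ g₂ : EdgeSet G
    g₁ = _⊕_ G f A₁
    g₂ = _⊕_ G f A₂
    A₁⊆ : ∀ e → member A₁ e ≡ true → member f e xor member F₁ e ≡ true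
    A₁⊆ = ⊆⊕⇒member A₁⊆f⊕F₁
    A₂⊆ : ∀ e → member A₂ e ≡ true → member f e xor member F₂ e ≡ true
    A₂⊆ = ⊆⊕⇒member A₂⊆f⊕F₂
    cancel : ∀ a b c → (a xor b) xor (a xor c) ≡ b xor c
    cancel = by-truth-table 3

  Opposite : Set
  Opposite = (ClockwiseEven G A₁ × ClockwiseOdd G A₂) ⊎ (ClockwiseOdd G A₁ × ClockwiseEven G A₂)

  signs-differ : Bool
  signs-differ = (sign f xor sign g₁) xor (sign f xor sign g₂)

  Opposite⇔signs-differ : Opposite ⇔ (signs-differ ≡ true)
  Opposite⇔signs-differ = mk⇔ to from
    where
    to : Opposite → signs-differ ≡ true
    to (inj₁ (even₁ , odd₂)) =
      cong₂ _xor_ (ClockwiseEven⇒sign-swap one-f oneF₁ A₁⊆ even₁) (ClockwiseOdd⇒sign-swap one-f oneF₂ A₂⊆ odd₂)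
    to (inj₂ (odd₁ , even₂)) =
      cong₂ _xor_ (ClockwiseOdd⇒sign-swap one-f oneF₁ A₁⊆ odd₁) (ClockwiseEven⇒sign-swap one-f oneF₂ A₂⊆ even₂)
    from : signs-differ ≡ true → Opposite
    from differ with sign f xor sign g₁ in s₁ | sign f xor sign g₂ in s₂
    ... | true  | false = inj₁ ( sign-swap⇒ClockwiseEven one-f oneF₁ A₁⊆ A₁-circuit s₁
                                , sign-swap⇒ClockwiseOdd one-f oneF₂ A₂⊆ A₂-circuit s₂)
    ... | false | true  = inj₂ ( sign-swap⇒ClockwiseOdd one-f oneF₁ A₁⊆ A₁-circuit s₁
                                , sign-swap⇒ClockwiseEven one-f oneF₂ A₂⊆ A₂-circuit s₂)

  g₁⊕g₂≡A₁⊕A₂ : _⊕_ G g₁ g₂ ≡ _⊕_ G A₁ A₂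
  g₁⊕g₂≡A₁⊕A₂ = member-ext λ e → begin
    member (_⊕_ G g₁ g₂) e
      ≡⟨ trans (member-⊕ g₁ g₂ e) (cong₂ _xor_ (member-⊕ f A₁ e) (member-⊕ f A₂ e)) ⟩
    (member f e xor member A₁ e) xor (member f e xor member A₂ e)
      ≡⟨ cancel (member f e) (member A₁ e) (member A₂ e) ⟩
    member A₁ e xor member A₂ e
      ≡⟨ sym (member-⊕ A₁ A₂ e) ⟩
    member (_⊕_ G A₁ A₂) e ∎
    where open ≡-Reasoning

  -- Every edge of g₁ ⊕ g₂ = A₁ ⊕ A₂ lies on A₁ or on A₂.
  loopless : ∀ e → member g₁ e xor member g₂ e ≡ true → tail e ≢ head e
  loopless e e∈ with member A₁ e in e∈A₁?
  ... | true  = circuit-loopless A₁-circuit e∈A₁?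
  ... | false = circuit-loopless A₂-circuit (begin
    member A₂ e                  ≡⟨ cong (_xor member A₂ e) (sym e∈A₁?) ⟩
    member A₁ e xor member A₂ e  ≡⟨ sym (member-⊕ A₁ A₂ e) ⟩
    member (_⊕_ G A₁ A₂) e       ≡⟨ cong (λ X → member X e) (sym g₁⊕g₂≡A₁⊕A₂) ⟩
    member (_⊕_ G g₁ g₂) e       ≡⟨ trans (member-⊕ g₁ g₂ e) e∈ ⟩
    true                         ∎)
    where open ≡-Reasoning

  private
    counted : CountResult (swap-oneFactor one-f oneF₂ A₂⊆ A₂-circuit) g₁
    counted = count (swap-oneFactor one-f oneF₂ A₂⊆ A₂-circuit) (swap-oneFactor one-f oneF₁ A₁⊆ A₁-circuit) loopless

  Cs : List (EdgeSet G)
  Cs = proj₁ counted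

  Cs-unique : Unique Cs
  Cs-unique = proj₁ (proj₁ (proj₂ counted))

  Cs-enumerates : ∀ C → C ∈ₗ Cs ⇔ Counted (_⊕_ G A₁ A₂) C
  Cs-enumerates = subst (λ S → ∀ C → C ∈ₗ Cs ⇔ Counted S C) g₁⊕g₂≡A₁⊕A₂ (proj₂ (proj₁ (proj₂ counted)))

  parity-Cs : parity (length Cs) ≡ signs-differ
  parity-Cs = trans (proj₂ (proj₂ counted)) (sym (cancel (sign f) (sign g₁) (sign g₂)))

lemma2 : (G : Digraph) (f A₁ A₂ : EdgeSet G) →
    IsOneFactor G f →
    IsFAlternating G f A₁ →
    IsFAlternating G f A₂ →
    ((ClockwiseEven G A₁ × ClockwiseOdd G A₂) ⊎ (ClockwiseOdd G A₁ × ClockwiseEven G A₂))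
      ⇔ (Σ ℕ λ k → Odd k ×
          HasCount G (λ C → (C ⊆ _⊕_ G A₁ A₂) × IsAlternating G C × ClockwiseEven G C) k)
lemma2 G f A₁ A₂ one-f (A₁-circuit , _ , oneF₁ , A₁⊆f⊕F₁) (A₂-circuit , _ , oneF₂ , A₂⊆f⊕F₂) = mk⇔
  (λ opposite → length Cs
              , Equivalence.from (Odd⇔parity≡true (length Cs))
                  (trans parity-Cs (Equivalence.to Opposite⇔signs-differ opposite))
              , Cs , Cs-unique , Cs-enumerates , refl)
  (λ (k , odd-k , Ds , Ds-unique , Ds-enumerates , |Ds|≡k) → Equivalence.from Opposite⇔signs-differ (begin
    signs-differ         ≡⟨ sym parity-Cs ⟩
    parity (length Cs)   ≡⟨ cong parity (enumerations-same-length Cs-unique Ds-unique Cs-enumerates Ds-enumerates) ⟩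
    parity (length Ds)   ≡⟨ cong parity |Ds|≡k ⟩
    parity k             ≡⟨ Equivalence.to (Odd⇔parity≡true k) odd-k ⟩
    true                 ∎))
  where
  open TwoCircuits G one-f A₁-circuit oneF₁ A₁⊆f⊕F₁ A₂-circuit oneF₂ A₂⊆f⊕F₂
  open ≡-Reasoning
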